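{- Let $d\ge0$ and let $S$ be a set of $d+1$ distinct integers. Let $A_S=\{f\in\mathbb R^{d+1}: f(s)\in\mathbb Z\text{ for all }s\in S\}$ and $H=\{f\in\mathbb R^{d+1}: f(n)\in2\mathbb Z\text{ for all }n\in\mathbb Z\}$. Then $H\subseteq A_S$ and the quotient $A_S/H$ has cardinality $$2^{d+1}\,\frac{\prod_{x,y\in S,\,x>y}(x-y)}{\prod_{n=1}^d n!}.$$
   Context: $\mathbb R^{d+1}$ is identified with the additive group of real polynomials in one variable of degree at most $d$.
   Formalization: The polynomials of degree at most d, which make up $A_S$ and $H$, have rational coefficients instead of real ones. -}

module Defs where

open import Data.Nat as ℕ using (ℕ; zero; suc; _!)
open import Data.Integer as ℤ using (ℤ; ∣_∣)
open import Data.Integer.Properties as ℤP using ()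
open import Data.Rational as ℚ using (ℚ)
open import Data.Fin using (Fin)
open import Data.Vec using (Vec; []; _∷_; lookup; zipWith)
open import Data.Nat.ListAction using (product)
open import Data.List using (List; map; concatMap; allFin; upTo)
open import Data.Product using (∃; _×_)
open import Data.Bool using (if_then_else_)
open import Relation.Nullary using (does)
open import Relation.Binary.PropositionalEquality using (_≡_)

-- Polynomials of degree ≤ d: coefficient vectors (c₀, …, c_d).
-- (ℚ replaces ℝ.)
Poly : ℕ → Set
Poly d = Vec ℚ (suc d)

eval : ∀ {n} → Vec ℚ n → ℚ → ℚ
eval []       x = ℚ.0ℚ
eval (c ∷ cs) x = c ℚ.+ x ℚ.* eval cs x

_-ₚ_ : ∀ {n} → Vec ℚ n → Vec ℚ n → Vec ℚ n
_-ₚ_ = zipWith ℚ._-_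

ι : ℤ → ℚ
ι z = z ℚ./ 1

IsInt : ℚ → Set
IsInt q = ∃ λ (k : ℤ) → q ≡ ι k

IsEvenInt : ℚ → Set
IsEvenInt q = ∃ λ (k : ℤ) → q ≡ ι (ℤ.+ 2 ℤ.* k)

Distinct : ∀ {n} → Vec ℤ n → Set
Distinct {n} S = ∀ (i j : Fin n) → lookup S i ≡ lookup S j → i ≡ j

InA : ∀ {d} → Vec ℤ (suc d) → Poly d → Set
InA {d} S f = ∀ (i : Fin (suc d)) → IsInt (eval f (ι (lookup S i)))

InH : ∀ {d} → Poly d → Set
InH f = ∀ (n : ℤ) → IsEvenInt (eval f (ι n))

diffProd : ∀ {n} → Vec ℤ n → ℕ
diffProd {n} S =
  product (concatMap (λ i → map (λ j →
    if does (lookup S j ℤP.<? lookup S i)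
    then ∣ lookup S i ℤ.- lookup S j ∣
    else 1) (allFin n)) (allFin n))

superfact : ℕ → ℕ
superfact d = product (map (λ k → (suc k) !) (upTo d))

-- |A_S / H| = m: a system of m representatives in A_S, pairwise
-- incongruent mod H, such that every element of A_S is congruent
-- mod H to one of them.
QuotientCard : ∀ {d} → Vec ℤ (suc d) → ℕ → Set
QuotientCard {d} S m =
  ∃ λ (r : Fin m → Poly d) →
    (∀ i → InA S (r i)) ×
    (∀ i j → InH (r i -ₚ r j) → i ≡ j) ×
    (∀ f → InA S f → ∃ λ i → InH (f -ₚ r i))

{-# OPTIONS --safe #-}
module Submission where

-- Induct on |S|, writing S = s ∷ S′, for polynomials with any number n of coefficients.
-- With K = {f ∈ A_S : f(s) even} one has [A_S : K] = 2, and g ↦ (X − s)·g identifies K/H with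
-- B/J, where B = {g : (x − s)·g(x) ∈ ℤ for x ∈ S′} and J = {g : (X − s)·g ∈ H}.  Both B ⊇ A_S′
-- and J ⊇ H are cut out by coordinates admitting a dual basis, the values at the points of S′
-- (Lagrange) and the differences Δʲg(s + 1) (Newton), and the two conditions differ
-- coordinatewise by the factors x − s, resp. j + 1 (Leibniz rule for Δ).  So [B : A_S′] = ∏ |x − s|
-- and [J : H] = n!, and [B : J]·n! = [B : A_S′]·[A_S′ : H] yields the recursion for [A_S : H].

open import Defs
import Data.Nat.Properties as ℕP
open import Algebra.Properties.CommutativeMonoid.Sum ℕP.*-1-commutativeMonoid using () renaming (sum to ∏)
open import Data.Empty using (⊥-elim)
open import Data.Fin as Fin using (Fin; zero; suc; toℕ)
import Data.Fin.Properties as Fin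
open import Data.Nat as ℕ using (ℕ; zero; suc)
open import Data.Product using (∃; _×_; _,_; proj₁; proj₂; uncurry)
open import Function using (_∘_; id)
open import Function.Definitions using (Injective)
open import Level using (0ℓ)
open import Relation.Binary.PropositionalEquality
  using (_≡_; _≢_; _≗_; refl; sym; trans; cong; cong₂; subst; module ≡-Reasoning)
open import Relation.Nullary using (yes; no; does)
open import Relation.Unary using (Pred; Decidable; U; _∩_; ⋂; _⊢_; _⊆′_; _≐_)
open import Relation.Unary.Properties using (≐-sym)

module IntegersInℚ where

  open import Data.Nat.Coprimality as Coprime using (Coprime; 1-coprimeTo)
  open import Data.Nat.Divisibility using (∣⇒≤)
  open import Data.Integer as ℤ using (ℤ; +_; -[1+_]; +[1+_]; ∣_∣)
  import Data.Integer.Properties as ℤP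
  open import Data.Integer.Divisibility.Signed using (_∣_; divides; _∣?_; ∣⇒∣ᵤ)
  open import Data.Integer.Solver using () renaming (module +-*-Solver to ℤ-Solver)
  open import Data.Rational as ℚ using (ℚ; mkℚ; 0ℚ; _+_; _*_; _-_; -_; 1/_)
  import Data.Rational.Properties as ℚP

  coprime-1 : ∀ n → Coprime n 1
  coprime-1 n = Coprime.sym (1-coprimeTo n)

  ι≡mkℚ : ∀ z → ι z ≡ mkℚ z 0 (coprime-1 ∣ z ∣)
  ι≡mkℚ (+ n)    = ℚP.normalize-coprime (coprime-1 n)
  ι≡mkℚ -[1+ n ] = cong -_ (ℚP.normalize-coprime (coprime-1 (suc n)))

  -- The middle term is what _+_ computes to on two fractions with denominator 1.
  ι-homo-+ : ∀ a b → ι (a ℤ.+ b) ≡ ι a + ι b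
  ι-homo-+ a b = begin
    ι (a ℤ.+ b)                     ≡⟨ cong ι (sym (cong₂ ℤ._+_ (ℤP.*-identityʳ a) (ℤP.*-identityʳ b))) ⟩
    (a ℤ.* + 1 ℤ.+ b ℤ.* + 1) ℚ./ 1 ≡⟨ sym (cong₂ _+_ (ι≡mkℚ a) (ι≡mkℚ b)) ⟩
    ι a + ι b                       ∎
    where open ≡-Reasoning

  ι-homo-* : ∀ a b → ι (a ℤ.* b) ≡ ι a * ι b
  ι-homo-* a b = sym (cong₂ _*_ (ι≡mkℚ a) (ι≡mkℚ b))

  ι-homo-neg : ∀ a → ι (ℤ.- a) ≡ - ι a
  ι-homo-neg a = trans (ι≡mkℚ (ℤ.- a)) (trans (mkℚ-neg a) (cong -_ (sym (ι≡mkℚ a))))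
    where
    mkℚ-neg : ∀ a → mkℚ (ℤ.- a) 0 (coprime-1 ∣ ℤ.- a ∣) ≡ - mkℚ a 0 (coprime-1 ∣ a ∣)
    mkℚ-neg (+ zero) = refl
    mkℚ-neg +[1+ n ] = refl
    mkℚ-neg -[1+ n ] = refl

  ι-homo-sub : ∀ a b → ι (a ℤ.- b) ≡ ι a - ι b
  ι-homo-sub a b = trans (ι-homo-+ a (ℤ.- b)) (cong (_+_ (ι a)) (ι-homo-neg b))

  ι-injective : ∀ {a b} → ι a ≡ ι b → a ≡ b
  ι-injective {a} {b} eq = cong ℚ.numerator (trans (sym (ι≡mkℚ a)) (trans eq (ι≡mkℚ b)))

  *-cancelˡ-≡ : ∀ {p} q r → p ≢ 0ℚ → p * q ≡ p * r → q ≡ r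
  *-cancelˡ-≡ {p} q r p≢0 eq = begin
    q               ≡⟨ sym (cancel q) ⟩
    p⁻¹ * (p * q)   ≡⟨ cong (p⁻¹ *_) eq ⟩
    p⁻¹ * (p * r)   ≡⟨ cancel r ⟩
    r               ∎
    where
    open ≡-Reasoning
    instance _ = ℚ.≢-nonZero p≢0
    p⁻¹ : ℚ
    p⁻¹ = 1/ p
    cancel : ∀ x → p⁻¹ * (p * x) ≡ x
    cancel x = trans (sym (ℚP.*-assoc p⁻¹ p x))
                 (trans (cong (_* x) (ℚP.*-inverseˡ p)) (ℚP.*-identityˡ x))

  Multiple : ℤ → ℚ → Set
  Multiple k q = ∃ λ z → q ≡ ι (k ℤ.* z)

  IsInt⇒Multiple1 : ∀ {q} → IsInt q → Multiple (+ 1) q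
  IsInt⇒Multiple1 (z , q≡z) = z , trans q≡z (cong ι (sym (ℤP.*-identityˡ z)))

  Multiple1⇒IsInt : ∀ {q} → Multiple (+ 1) q → IsInt q
  Multiple1⇒IsInt (z , q≡z) = z , trans q≡z (cong ι (ℤP.*-identityˡ z))

  IsEvenInt⇒IsInt : ∀ {q} → IsEvenInt q → IsInt q
  IsEvenInt⇒IsInt (z , q≡2z) = + 2 ℤ.* z , q≡2z

  IsInt-scaled : ∀ c → IsInt ⊆′ λ y → IsInt (ι c * y)
  IsInt-scaled c _ (z , refl) = c ℤ.* z , sym (ι-homo-* c z)

  Multiple-scaled : ∀ {k} c → Multiple k ⊆′ λ y → Multiple k (ι c * y)
  Multiple-scaled {k} c _ (z , refl) =
    c ℤ.* z , trans (sym (ι-homo-* c (k ℤ.* z))) (cong ι (c[kz]≡k[cz] c k z))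
    where
    open ℤ-Solver
    c[kz]≡k[cz] : ∀ c k z → c ℤ.* (k ℤ.* z) ≡ k ℤ.* (c ℤ.* z)
    c[kz]≡k[cz] = solve 3 (λ c k z → c :* (k :* z) := k :* (c :* z)) refl

  multiple? : ∀ k → Decidable (Multiple k)
  multiple? k (mkℚ n zero _) with k ∣? n
  ... | yes (divides z n≡z*k) = yes (z , trans (sym (ι≡mkℚ n)) (cong ι (trans n≡z*k (ℤP.*-comm z k))))
  ... | no k∤n =
    no λ (z , eq) → k∤n (divides z (trans (ι-injective (trans (ι≡mkℚ n) eq)) (ℤP.*-comm k z)))
  multiple? k (mkℚ n (suc d) _) =
    no λ (z , eq) → ℕP.1+n≢0 (cong ℚ.denominator-1 (trans eq (ι≡mkℚ (k ℤ.* z))))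

  incongruent-residues : ∀ {c} (a b : Fin ∣ c ∣) → c ∣ (+ toℕ a ℤ.- + toℕ b) → a ≡ b
  incongruent-residues {c} a b c∣a-b with toℕ a ℕ.≟ toℕ b
  ... | yes a≡b = Fin.toℕ-injective a≡b
  ... | no a≢b = ⊥-elim (ℕP.<-irrefl refl (ℕP.<-≤-trans ∣a-b∣<∣c∣ ∣c∣≤∣a-b∣))
    where
    ∣a-b∣ : ℕ
    ∣a-b∣ = ∣ + toℕ a ℤ.- + toℕ b ∣
    ∣a-b∣≢0 : ∣a-b∣ ≢ 0
    ∣a-b∣≢0 eq = a≢b (ℤP.+-injective (ℤP.i-j≡0⇒i≡j _ _ (ℤP.∣i∣≡0⇒i≡0 eq)))
    ∣c∣≤∣a-b∣ : ∣ c ∣ ℕ.≤ ∣a-b∣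
    ∣c∣≤∣a-b∣ = ∣⇒≤ ⦃ ℕ.≢-nonZero ∣a-b∣≢0 ⦄ (∣⇒∣ᵤ c∣a-b)
    ∣a-b∣<∣c∣ : ∣a-b∣ ℕ.< ∣ c ∣
    ∣a-b∣<∣c∣ = begin-strict
      ∣a-b∣               ≡⟨ cong ∣_∣ (ℤP.m-n≡m⊖n (toℕ a) (toℕ b)) ⟩
      ∣ toℕ a ℤ.⊖ toℕ b ∣  ≤⟨ ℤP.∣m⊝n∣≤m⊔n (toℕ a) (toℕ b) ⟩
      toℕ a ℕ.⊔ toℕ b     <⟨ ℕP.⊔-lub (Fin.toℕ<n a) (Fin.toℕ<n b) ⟩
      ∣ c ∣               ∎
      where open ℕP.≤-Reasoning

open IntegersInℚ

module RationalVectors where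

  open import Data.Rational as ℚ using (ℚ; 0ℚ; _+_; _*_; _-_)
  import Data.Rational.Properties as ℚP
  open import Data.Rational.Solver using (module +-*-Solver)
  open import Data.Vec using (Vec; []; _∷_; zipWith; replicate; map)
  open +-*-Solver

  _+ₚ_ : ∀ {n} → Vec ℚ n → Vec ℚ n → Vec ℚ n
  _+ₚ_ = zipWith _+_

  0ₚ : ∀ {n} → Vec ℚ n
  0ₚ = replicate _ 0ℚ

  _·ₚ_ : ∀ {n} → ℚ → Vec ℚ n → Vec ℚ n
  c ·ₚ f = map (c *_) f

  f-f≡0 : ∀ {n} (f : Vec ℚ n) → f -ₚ f ≡ 0ₚ
  f-f≡0 []      = refl
  f-f≡0 (x ∷ f) = cong₂ _∷_ (ℚP.+-inverseʳ x) (f-f≡0 f)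

  f-0≡f : ∀ {n} (f : Vec ℚ n) → f -ₚ 0ₚ ≡ f
  f-0≡f []      = refl
  f-0≡f (x ∷ f) = cong₂ _∷_ (ℚP.+-identityʳ x) (f-0≡f f)

  0-[f-g]≡g-f : ∀ {n} (f g : Vec ℚ n) → 0ₚ -ₚ (f -ₚ g) ≡ g -ₚ f
  0-[f-g]≡g-f []      []      = refl
  0-[f-g]≡g-f (x ∷ f) (y ∷ g) =
    cong₂ _∷_ (solve 2 (λ x y → con 0ℚ :- (x :- y) := y :- x) refl x y) (0-[f-g]≡g-f f g)

  [f-g]+[g-h]≡f-h : ∀ {n} (f g h : Vec ℚ n) → (f -ₚ g) +ₚ (g -ₚ h) ≡ f -ₚ h
  [f-g]+[g-h]≡f-h []      []      []      = refl
  [f-g]+[g-h]≡f-h (x ∷ f) (y ∷ g) (z ∷ h) =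
    cong₂ _∷_ (solve 3 (λ x y z → (x :- y) :+ (y :- z) := x :- z) refl x y z) ([f-g]+[g-h]≡f-h f g h)

  [f-g]-h≡f-[g+h] : ∀ {n} (f g h : Vec ℚ n) → (f -ₚ g) -ₚ h ≡ f -ₚ (g +ₚ h)
  [f-g]-h≡f-[g+h] []      []      []      = refl
  [f-g]-h≡f-[g+h] (x ∷ f) (y ∷ g) (z ∷ h) =
    cong₂ _∷_ (solve 3 (λ x y z → (x :- y) :- z := x :- (y :+ z)) refl x y z) ([f-g]-h≡f-[g+h] f g h)

  [f+g]-[f+h]≡g-h : ∀ {n} (f g h : Vec ℚ n) → (f +ₚ g) -ₚ (f +ₚ h) ≡ g -ₚ h
  [f+g]-[f+h]≡g-h []      []      []      = refl
  [f+g]-[f+h]≡g-h (x ∷ f) (y ∷ g) (z ∷ h) =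
    cong₂ _∷_ (solve 3 (λ x y z → (x :+ y) :- (x :+ z) := y :- z) refl x y z) ([f+g]-[f+h]≡g-h f g h)

  [f+g]-[h+k]-[g-k]≡f-h : ∀ {n} (f g h k : Vec ℚ n) → ((f +ₚ g) -ₚ (h +ₚ k)) -ₚ (g -ₚ k) ≡ f -ₚ h
  [f+g]-[h+k]-[g-k]≡f-h []      []      []      []      = refl
  [f+g]-[h+k]-[g-k]≡f-h (x ∷ f) (y ∷ g) (z ∷ h) (w ∷ k) =
    cong₂ _∷_ (solve 4 (λ x y z w → (x :+ y) :- (z :+ w) :- (y :- w) := x :- z) refl x y z w)
              ([f+g]-[h+k]-[g-k]≡f-h f g h k)

open RationalVectors

module Subgroups where

  open import Data.Integer as ℤ using (ℤ; +_)
  import Data.Integer.Properties as ℤP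
  open import Data.Integer.Solver using () renaming (module +-*-Solver to ℤ-Solver)
  open import Data.Rational as ℚ using (ℚ; 0ℚ; _+_; _*_; _-_)
  import Data.Rational.Properties as ℚP
  open import Data.Rational.Solver using (module +-*-Solver)
  open import Data.Unit using (tt)
  open import Data.Vec using (Vec)

  record IsSubgroup {A : Set} (0# : A) (_+_ _-_ : A → A → A) (P : Pred A 0ℓ) : Set where
    field
      0∈ : P 0#
      +∈ : ∀ {x y} → P x → P y → P (x + y)
      -∈ : ∀ {x y} → P x → P y → P (x - y)

  open IsSubgroup public

  IsSubgroupℚ : Pred ℚ 0ℓ → Set
  IsSubgroupℚ = IsSubgroup 0ℚ _+_ _-_

  IsSubgroupᵥ : ∀ n → Pred (Vec ℚ n) 0ℓ → Set
  IsSubgroupᵥ n = IsSubgroup 0ₚ _+ₚ_ _-ₚ_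

  IsInt-isSubgroup : IsSubgroupℚ IsInt
  IsInt-isSubgroup = record
    { 0∈ = + 0 , refl
    ; +∈ = λ { (a , refl) (b , refl) → a ℤ.+ b , sym (ι-homo-+ a b) }
    ; -∈ = λ { (a , refl) (b , refl) → a ℤ.- b , sym (ι-homo-sub a b) }
    }

  multiple-isSubgroup : ∀ k → IsSubgroupℚ (Multiple k)
  multiple-isSubgroup k = record
    { 0∈ = + 0 , cong ι (sym (ℤP.*-zeroʳ k))
    ; +∈ = λ { (a , refl) (b , refl) →
        a ℤ.+ b , trans (sym (ι-homo-+ (k ℤ.* a) (k ℤ.* b))) (cong ι (sym (ℤP.*-distribˡ-+ k a b))) }
    ; -∈ = λ { (a , refl) (b , refl) →
        a ℤ.- b , trans (sym (ι-homo-sub (k ℤ.* a) (k ℤ.* b))) (cong ι (*-distribˡ-sub a b)) }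
    }
    where
    open ℤ-Solver
    *-distribˡ-sub : ∀ a b → k ℤ.* a ℤ.- k ℤ.* b ≡ k ℤ.* (a ℤ.- b)
    *-distribˡ-sub = solve 3 (λ k a b → k :* a :- k :* b := k :* (a :- b)) refl k

  IsEvenInt-isSubgroup : IsSubgroupℚ IsEvenInt
  IsEvenInt-isSubgroup = multiple-isSubgroup (+ 2)

  scaled-isSubgroup : ∀ c {P} → IsSubgroupℚ P → IsSubgroupℚ (λ y → P (c * y))
  scaled-isSubgroup c {P} P-sub = record
    { 0∈ = subst P (sym (ℚP.*-zeroʳ c)) (0∈ P-sub)
    ; +∈ = λ {x} {y} p q → subst P (sym (ℚP.*-distribˡ-+ c x y)) (+∈ P-sub p q)
    ; -∈ = λ {x} {y} p q → subst P (sym (*-distribˡ-sub x y)) (-∈ P-sub p q)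
    }
    where
    open +-*-Solver
    *-distribˡ-sub : ∀ x y → c * (x - y) ≡ c * x - c * y
    *-distribˡ-sub = solve 3 (λ c x y → c :* (x :- y) := c :* x :- c :* y) refl c

  U-isSubgroup : ∀ {n} → IsSubgroupᵥ n U
  U-isSubgroup = record { 0∈ = tt ; +∈ = λ _ _ → tt ; -∈ = λ _ _ → tt }

  ∩-isSubgroup : ∀ {n} {P Q : Pred (Vec ℚ n) 0ℓ} →
                 IsSubgroupᵥ n P → IsSubgroupᵥ n Q → IsSubgroupᵥ n (P ∩ Q)
  ∩-isSubgroup P-sub Q-sub = record
    { 0∈ = 0∈ P-sub , 0∈ Q-sub
    ; +∈ = λ (p , q) (p′ , q′) → +∈ P-sub p p′ , +∈ Q-sub q q′
    ; -∈ = λ (p , q) (p′ , q′) → -∈ P-sub p p′ , -∈ Q-sub q q′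
    }

  record IsAdditive {n} (ℓ : Vec ℚ n → ℚ) : Set where
    field
      homo-0 : ℓ 0ₚ ≡ 0ℚ
      homo-+ : ∀ f g → ℓ (f +ₚ g) ≡ ℓ f + ℓ g
      homo-sub : ∀ f g → ℓ (f -ₚ g) ≡ ℓ f - ℓ g

  open IsAdditive public

  preimage-isSubgroup : ∀ {n} {ℓ : Vec ℚ n → ℚ} {Q : Pred ℚ 0ℓ} →
                        IsAdditive ℓ → IsSubgroupℚ Q → IsSubgroupᵥ n (ℓ ⊢ Q)
  preimage-isSubgroup {ℓ = ℓ} {Q} ℓ-add Q-sub = record
    { 0∈ = subst Q (sym (homo-0 ℓ-add)) (0∈ Q-sub)
    ; +∈ = λ {f} {g} p q → subst Q (sym (homo-+ ℓ-add f g)) (+∈ Q-sub p q)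
    ; -∈ = λ {f} {g} p q → subst Q (sym (homo-sub ℓ-add f g)) (-∈ Q-sub p q)
    }

  ⋂-isSubgroup : ∀ {n} {I : Set} {P : I → Pred (Vec ℚ n) 0ℓ} →
                 (∀ i → IsSubgroupᵥ n (P i)) → IsSubgroupᵥ n (⋂ I P)
  ⋂-isSubgroup P-sub = record
    { 0∈ = λ i → 0∈ (P-sub i)
    ; +∈ = λ p q i → +∈ (P-sub i) (p i) (q i)
    ; -∈ = λ p q i → -∈ (P-sub i) (p i) (q i)
    }

  isSubgroup-resp-≐ : ∀ {n} {P Q : Pred (Vec ℚ n) 0ℓ} → P ≐ Q → IsSubgroupᵥ n P → IsSubgroupᵥ n Q
  isSubgroup-resp-≐ (P⊆Q , Q⊆P) P-sub = record
    { 0∈ = P⊆Q (0∈ P-sub)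
    ; +∈ = λ p q → P⊆Q (+∈ P-sub (Q⊆P p) (Q⊆P q))
    ; -∈ = λ p q → P⊆Q (-∈ P-sub (Q⊆P p) (Q⊆P q))
    }

open Subgroups

module Indices where

  open import Data.Integer as ℤ using (ℤ; +_; ∣_∣)
  import Data.Integer.Properties as ℤP
  open import Data.Integer.DivMod using (_/_; _%_; n%d<d; a≡a%n+[a/n]*n)
  open import Data.Integer.Divisibility.Signed using (divides)
  open import Data.Integer.Solver using () renaming (module +-*-Solver to ℤ-Solver)
  open import Data.Rational as ℚ using (ℚ; 0ℚ; _*_; _-_; 1/_)
  import Data.Rational.Properties as ℚP
  open import Data.Rational.Solver using (module +-*-Solver)
  open import Data.Unit using (tt)
  open import Data.Vec using (Vec)

  record Index {V : Set} (_−_ : V → V → V) (X Z : Pred V 0ℓ) (m : ℕ) : Set where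
    field
      rep           : Fin m → V
      rep∈          : ∀ i → X (rep i)
      rep-injective : ∀ i j → Z (rep i − rep j) → i ≡ j
      rep-cover     : ∀ {f} → X f → ∃ λ i → Z (f − rep i)

  Indexᵥ : ∀ {n} → Pred (Vec ℚ n) 0ℓ → Pred (Vec ℚ n) 0ℓ → ℕ → Set
  Indexᵥ = Index _-ₚ_

  module _ {V W : Set} {_−_ : V → V → V} {_−′_ : W → W → W} where

    Index-transfer : ∀ {X Z : Pred V 0ℓ} {X′ Z′ : Pred W 0ℓ} {m} (φ : V → W) →
                     (∀ {g} → X g → X′ (φ g)) →
                     (∀ {g h} → Z′ (φ g −′ φ h) → Z (g − h)) →
                     (∀ {f} → X′ f → ∃ λ g → X g × (∀ {h} → Z (g − h) → Z′ (f −′ φ h))) →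
                     Index _−_ X Z m → Index _−′_ X′ Z′ m
    Index-transfer φ φ-∈ φ-reflects lift idx = record
      { rep           = φ ∘ rep
      ; rep∈          = φ-∈ ∘ rep∈
      ; rep-injective = λ i j z → rep-injective i j (φ-reflects z)
      ; rep-cover     = λ x′ → let g , x , lifts = lift x′ ; i , z = rep-cover x in i , lifts z
      }
      where open Index idx

  Index-cong : ∀ {V} {_−_ : V → V → V} {X Z X′ Z′ : Pred V 0ℓ} {m} →
               X ≐ X′ → Z ≐ Z′ → Index _−_ X Z m → Index _−_ X′ Z′ m
  Index-cong (X⊆X′ , X′⊆X) (Z⊆Z′ , Z′⊆Z) =
    Index-transfer id X⊆X′ Z′⊆Z (λ x′ → _ , X′⊆X x′ , Z⊆Z′)

  module _ {n : ℕ} where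

    private
      V : Set
      V = Vec ℚ n

    module _ {Z : Pred V 0ℓ} (Z-sub : IsSubgroupᵥ n Z) where

      ≈-refl : ∀ f → Z (f -ₚ f)
      ≈-refl f = subst Z (sym (f-f≡0 f)) (0∈ Z-sub)

      ≈-sym : ∀ {f g} → Z (f -ₚ g) → Z (g -ₚ f)
      ≈-sym {f} {g} z = subst Z (0-[f-g]≡g-f f g) (-∈ Z-sub (0∈ Z-sub) z)

      ≈-trans : ∀ {f g h} → Z (f -ₚ g) → Z (g -ₚ h) → Z (f -ₚ h)
      ≈-trans {f} {g} {h} z z′ = subst Z ([f-g]+[g-h]≡f-h f g h) (+∈ Z-sub z z′)

    Index-refl : ∀ {X} → IsSubgroupᵥ n X → Indexᵥ X X 1
    Index-refl {X} X-sub = record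
      { rep           = λ _ → 0ₚ
      ; rep∈          = λ _ → 0∈ X-sub
      ; rep-injective = λ { zero zero _ → refl }
      ; rep-cover     = λ {f} x → zero , subst X (sym (f-0≡f f)) x
      }

    Index-* : ∀ {X Y Z a b} → Indexᵥ X Y a → Indexᵥ Y Z b →
              IsSubgroupᵥ n X → IsSubgroupᵥ n Y → Y ⊆′ X → Z ⊆′ Y → Indexᵥ X Z (a ℕ.* b)
    Index-* {X} {Y} {Z} {a} {b} X/Y Y/Z X-sub Y-sub Y⊆X Z⊆Y = record
      { rep           = λ k → rep′ (remQuot k)
      ; rep∈          = λ k → +∈ X-sub (X/Y.rep∈ _) (Y⊆X _ (Y/Z.rep∈ _))
      ; rep-injective = λ k k′ z →
          trans (sym (Fin.combine-remQuot {a} b k))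
                (trans (cong (uncurry Fin.combine) (rep′-injective (remQuot k) (remQuot k′) z))
                       (Fin.combine-remQuot {a} b k′))
      ; rep-cover     = cover
      }
      where
      module X/Y = Index X/Y
      module Y/Z = Index Y/Z
      remQuot : Fin (a ℕ.* b) → Fin a × Fin b
      remQuot = Fin.remQuot {a} b
      rep′ : Fin a × Fin b → V
      rep′ (i , j) = X/Y.rep i +ₚ Y/Z.rep j

      rep′-injective : ∀ p q → Z (rep′ p -ₚ rep′ q) → p ≡ q
      rep′-injective (i , j) (i′ , j′) z with X/Y.rep-injective i i′ i≈i′
        where
        i≈i′ : Y (X/Y.rep i -ₚ X/Y.rep i′)
        i≈i′ = subst Y ([f+g]-[h+k]-[g-k]≡f-h _ _ _ _)
                       (-∈ Y-sub (Z⊆Y _ z) (-∈ Y-sub (Y/Z.rep∈ j) (Y/Z.rep∈ j′)))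
      ... | refl = cong (i ,_) (Y/Z.rep-injective j j′ (subst Z ([f+g]-[f+h]≡g-h _ _ _) z))

      cover : ∀ {f} → X f → ∃ λ k → Z (f -ₚ rep′ (remQuot k))
      cover {f} x =
        let i , y = X/Y.rep-cover x
            j , z = Y/Z.rep-cover y
        in Fin.combine i j ,
           subst (λ p → Z (f -ₚ rep′ p)) (sym (Fin.remQuot-combine i j))
                 (subst Z ([f-g]-h≡f-[g+h] f (X/Y.rep i) (Y/Z.rep j)) z)

    Index-unique : ∀ {X Z a b} → IsSubgroupᵥ n Z → Indexᵥ X Z a → Indexᵥ X Z b → a ≡ b
    Index-unique {X} {Z} Z-sub I J = Fin.cantor-schröder-bernstein (classify-injective I J) (classify-injective J I)
      where
      module _ {a b} (I : Indexᵥ X Z a) (J : Indexᵥ X Z b) where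
        open Index

        classify : Fin a → Fin b
        classify i = proj₁ (rep-cover J (rep∈ I i))

        classify-injective : ∀ {i i′} → classify i ≡ classify i′ → i ≡ i′
        classify-injective {i} {i′} eq = rep-injective I i i′ (≈-trans Z-sub (≈ i) (≈-sym Z-sub i′≈))
          where
          ≈ : ∀ i → Z (rep I i -ₚ rep J (classify i))
          ≈ i = proj₂ (rep-cover J (rep∈ I i))
          i′≈ : Z (rep I i′ -ₚ rep J (classify i))
          i′≈ = subst (λ k → Z (rep I i′ -ₚ rep J k)) (sym eq) (≈ i′)

    Image : ∀ {k} → (Fin k → V) → Pred V 0ℓ
    Image R f = ∃ λ i → R i ≡ f

    Index-image : ∀ {Y} → IsSubgroupᵥ n Y → Decidable Y →
                  ∀ {k} (R : Fin k → V) → ∃ λ m → Indexᵥ (Image R) Y m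
    Index-image Y-sub Y? {zero} R = 0 , record
      { rep = λ () ; rep∈ = λ () ; rep-injective = λ () ; rep-cover = λ { (() , _) } }
    Index-image {Y} Y-sub Y? {suc k} R with Index-image Y-sub Y? (R ∘ suc)
    ... | m , idx with Fin.any? (λ j → Y? (R zero -ₚ Index.rep idx j))
    ...   | yes (j , y) = m , record
      { rep           = rep
      ; rep∈          = λ j → let i , eq = rep∈ j in suc i , eq
      ; rep-injective = rep-injective
      ; rep-cover     = λ { (zero , refl) → j , y ; (suc i , refl) → rep-cover (i , refl) }
      }
      where open Index idx
    ...   | no R₀≉rep = suc m , record
      { rep           = rep₀
      ; rep∈          = rep₀∈
      ; rep-injective = rep₀-injective
      ; rep-cover     = rep₀-cover
      }
      where
      open Index idx
      rep₀ : Fin (suc m) → V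
      rep₀ zero    = R zero
      rep₀ (suc j) = rep j

      rep₀∈ : ∀ j → Image R (rep₀ j)
      rep₀∈ zero    = zero , refl
      rep₀∈ (suc j) = let i , eq = rep∈ j in suc i , eq

      rep₀-injective : ∀ i j → Y (rep₀ i -ₚ rep₀ j) → i ≡ j
      rep₀-injective zero    zero    _ = refl
      rep₀-injective zero    (suc j) y = ⊥-elim (R₀≉rep (j , y))
      rep₀-injective (suc i) zero    y = ⊥-elim (R₀≉rep (i , ≈-sym Y-sub y))
      rep₀-injective (suc i) (suc j) y = cong suc (rep-injective i j y)

      rep₀-cover : ∀ {f} → Image R f → ∃ λ j → Y (f -ₚ rep₀ j)
      rep₀-cover (zero  , refl) = zero , ≈-refl Y-sub (R zero)
      rep₀-cover (suc i , refl) = let j , y = rep-cover (i , refl) in suc j , y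

    Index-coarsen : ∀ {X Y Z k} → IsSubgroupᵥ n Y → Decidable Y → Z ⊆′ Y →
                    Indexᵥ X Z k → ∃ λ m → Indexᵥ X Y m
    Index-coarsen {X} {Y} Y-sub Y? Z⊆Y X/Z = m , record
      { rep           = rep img
      ; rep∈          = λ j → let i , eq = rep∈ img j in subst X eq (rep∈ X/Z i)
      ; rep-injective = rep-injective img
      ; rep-cover     = λ x → let i , z = rep-cover X/Z x
                                  j , y = rep-cover img (i , refl)
                              in j , ≈-trans Y-sub (Z⊆Y _ z) y
      }
      where
      open Index
      m : ℕ
      m = proj₁ (Index-image Y-sub Y? (rep X/Z))
      img : Indexᵥ (Image (rep X/Z)) Y m
      img = proj₂ (Index-image Y-sub Y? (rep X/Z))

    Index-one-step : ∀ {U : Pred V 0ℓ} {Q P : Pred ℚ 0ℓ} {c} (ℓ : V → ℚ) (e : ℚ → V) →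
                     IsSubgroupᵥ n U → IsAdditive ℓ → (∀ q → ℓ (e q) ≡ q) →
                     (∀ {q} → Q q → U (e q)) → Index _-_ Q P c → Indexᵥ (U ∩ ℓ ⊢ Q) (U ∩ ℓ ⊢ P) c
    Index-one-step {U} {Q} {P} ℓ e U-sub ℓ-add ℓ∘e Q⇒U Q/P = record
      { rep           = e ∘ rep
      ; rep∈          = λ a → Q⇒U (rep∈ a) , subst Q (sym (ℓ∘e (rep a))) (rep∈ a)
      ; rep-injective = λ a b (_ , p) → rep-injective a b (subst P (ℓ-e-sub (rep a) (rep b)) p)
      ; rep-cover     = λ {f} (u , q) → let a , p = rep-cover q in
                          a , -∈ U-sub u (Q⇒U (rep∈ a)) , subst P (sym (ℓ-sub-e f (rep a))) p
      }
      where
      open Index Q/P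
      ℓ-sub-e : ∀ f q → ℓ (f -ₚ e q) ≡ ℓ f - q
      ℓ-sub-e f q = trans (homo-sub ℓ-add f (e q)) (cong (ℓ f -_) (ℓ∘e q))
      ℓ-e-sub : ∀ q r → ℓ (e q -ₚ e r) ≡ q - r
      ℓ-e-sub q r = trans (ℓ-sub-e (e q) r) (cong (_- r) (ℓ∘e q))

    record Coordinates (k : ℕ) : Set where
      field
        coord          : Fin k → V → ℚ
        coord-additive : ∀ i → IsAdditive (coord i)
        dual           : Fin k → ℚ → V
        coord-dual-≡   : ∀ i q → coord i (dual i q) ≡ q
        coord-dual-≢   : ∀ {i j} q → i ≢ j → coord i (dual j q) ≡ 0ℚ

    Coordinates-tail : ∀ {k} → Coordinates (suc k) → Coordinates k
    Coordinates-tail C = record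
      { coord          = coord ∘ suc
      ; coord-additive = coord-additive ∘ suc
      ; dual           = dual ∘ suc
      ; coord-dual-≡   = coord-dual-≡ ∘ suc
      ; coord-dual-≢   = λ q i≢j → coord-dual-≢ q (i≢j ∘ Fin.suc-injective)
      }
      where open Coordinates C

    -- Tighten coordinate 0 by Index-one-step, then treat the tightened condition as part of W.
    Index-coordinates-∩ : ∀ {k} (C : Coordinates k) {W : Pred V 0ℓ}
                            {Q P : Fin k → Pred ℚ 0ℓ} {c : Fin k → ℕ} →
                          IsSubgroupᵥ n W → (∀ i q → W (Coordinates.dual C i q)) →
                          (∀ i → IsSubgroupℚ (Q i)) → (∀ i → IsSubgroupℚ (P i)) → (∀ i → P i ⊆′ Q i) →
                          (∀ i → Index _-_ (Q i) (P i) (c i)) →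
                          Indexᵥ (W ∩ ⋂ (Fin k) λ i → Coordinates.coord C i ⊢ Q i)
                                 (W ∩ ⋂ (Fin k) λ i → Coordinates.coord C i ⊢ P i) (∏ c)
    Index-coordinates-∩ {zero} C W-sub _ _ _ _ _ =
      Index-cong ((λ w → w , λ ()) , proj₁) ((λ w → w , λ ()) , proj₁) (Index-refl W-sub)
    Index-coordinates-∩ {suc k} C {W} {Q} {P} {c} W-sub W-dual Q-sub P-sub P⊆Q Q/P =
      Index-cong X₁≐X Z₁≐Z
        (Index-* first (Index-cong Y₁′≐Y₁ (id , id) rest) X₁-sub Y₁-sub
          (λ _ (w , p) → w , P⊆Q zero _ p) (λ _ ((w , p) , ps) → (w , λ i → P⊆Q (suc i) _ (ps i)) , p))
      where
      open Coordinates C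
      Qs Wrest W′ : Pred V 0ℓ
      Qs = ⋂ (Fin k) λ i → coord (suc i) ⊢ Q (suc i)
      Wrest = W ∩ Qs
      W′ = W ∩ coord zero ⊢ P zero

      Wrest-sub : IsSubgroupᵥ n Wrest
      Wrest-sub = ∩-isSubgroup W-sub
        (⋂-isSubgroup λ i → preimage-isSubgroup (coord-additive (suc i)) (Q-sub (suc i)))

      X₁-sub : IsSubgroupᵥ n (Wrest ∩ coord zero ⊢ Q zero)
      X₁-sub = ∩-isSubgroup Wrest-sub (preimage-isSubgroup (coord-additive zero) (Q-sub zero))
      Y₁-sub : IsSubgroupᵥ n (Wrest ∩ coord zero ⊢ P zero)
      Y₁-sub = ∩-isSubgroup Wrest-sub (preimage-isSubgroup (coord-additive zero) (P-sub zero))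
      W′-sub : IsSubgroupᵥ n W′
      W′-sub = ∩-isSubgroup W-sub (preimage-isSubgroup (coord-additive zero) (P-sub zero))

      off-diagonal : ∀ {R : Pred ℚ 0ℓ} {i j} q → IsSubgroupℚ R → i ≢ j → R (coord i (dual j q))
      off-diagonal {R} q R-sub i≢j = subst R (sym (coord-dual-≢ q i≢j)) (0∈ R-sub)

      first : Indexᵥ (Wrest ∩ coord zero ⊢ Q zero) (Wrest ∩ coord zero ⊢ P zero) (c zero)
      first = Index-one-step (coord zero) (dual zero) Wrest-sub (coord-additive zero) (coord-dual-≡ zero)
                (λ {q} _ → W-dual zero q , λ i → off-diagonal q (Q-sub (suc i)) λ ())
                (Q/P zero)

      rest : Indexᵥ (W′ ∩ Qs) (W′ ∩ ⋂ (Fin k) λ i → coord (suc i) ⊢ P (suc i)) (∏ (c ∘ suc))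
      rest = Index-coordinates-∩ (Coordinates-tail C) W′-sub
               (λ i q → W-dual (suc i) q , off-diagonal q (P-sub zero) λ ())
               (Q-sub ∘ suc) (P-sub ∘ suc) (P⊆Q ∘ suc) (Q/P ∘ suc)

      X₁≐X : Wrest ∩ coord zero ⊢ Q zero ≐ W ∩ ⋂ (Fin (suc k)) λ i → coord i ⊢ Q i
      X₁≐X = (λ ((w , qs) , q) → w , Fin.∀-cons q qs) , (λ (w , qs) → (w , qs ∘ suc) , qs zero)
      Z₁≐Z : W′ ∩ (⋂ (Fin k) λ i → coord (suc i) ⊢ P (suc i)) ≐
             W ∩ ⋂ (Fin (suc k)) λ i → coord i ⊢ P i
      Z₁≐Z = (λ ((w , p) , ps) → w , Fin.∀-cons p ps) , (λ (w , ps) → (w , ps zero) , ps ∘ suc)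
      Y₁′≐Y₁ : W′ ∩ Qs ≐ Wrest ∩ coord zero ⊢ P zero
      Y₁′≐Y₁ = (λ ((w , p) , qs) → (w , qs) , p) , (λ ((w , qs) , p) → (w , p) , qs)

    Index-coordinates : ∀ {k} (C : Coordinates k) {Q P : Fin k → Pred ℚ 0ℓ} {c : Fin k → ℕ} →
                        (∀ i → IsSubgroupℚ (Q i)) → (∀ i → IsSubgroupℚ (P i)) → (∀ i → P i ⊆′ Q i) →
                        (∀ i → Index _-_ (Q i) (P i) (c i)) →
                        Indexᵥ (⋂ (Fin k) λ i → Coordinates.coord C i ⊢ Q i)
                               (⋂ (Fin k) λ i → Coordinates.coord C i ⊢ P i) (∏ c)
    Index-coordinates C Q-sub P-sub P⊆Q Q/P =
      Index-cong (proj₂ , (tt ,_)) (proj₂ , (tt ,_))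
        (Index-coordinates-∩ C U-isSubgroup (λ _ _ → tt) Q-sub P-sub P⊆Q Q/P)

  Index-multiples : ∀ {k c} → k ≢ + 0 → c ≢ + 0 →
                    Index _-_ (λ y → Multiple k (ι c * y)) (Multiple k) ∣ c ∣
  Index-multiples {k} {c} k≢0 c≢0 = record
    { rep           = ρ
    ; rep∈          = λ a → + toℕ a , c*ρ a
    ; rep-injective = injective
    ; rep-cover     = cover
    }
    where
    ιc≢0 : ι c ≢ 0ℚ
    ιc≢0 = c≢0 ∘ ι-injective
    instance
      _ = ℤ.≢-nonZero k≢0
      _ = ℤ.≢-nonZero c≢0
      _ = ℚ.≢-nonZero ιc≢0

    κ : Fin ∣ c ∣ → ℚ
    κ a = ι (k ℤ.* + toℕ a)

    ρ : Fin ∣ c ∣ → ℚ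
    ρ a = κ a * 1/ ι c

    c*ρ : ∀ a → ι c * ρ a ≡ κ a
    c*ρ a = trans (ℚP.*-comm (ι c) (ρ a))
              (trans (ℚP.*-assoc (κ a) (1/ ι c) (ι c))
                (trans (cong (κ a *_) (ℚP.*-inverseˡ (ι c))) (ℚP.*-identityʳ (κ a))))

    c*[y-ρ] : ∀ y a → ι c * (y - ρ a) ≡ ι c * y - κ a
    c*[y-ρ] y a = trans (solve 3 (λ c y r → c :* (y :- r) := c :* y :- c :* r) refl (ι c) y (ρ a))
                        (cong (ι c * y -_) (c*ρ a))
      where open +-*-Solver

    injective : ∀ a b → Multiple k (ρ a - ρ b) → a ≡ b
    injective a b (z , ρa-ρb≡kz) =
      incongruent-residues a b (divides z (ℤP.*-cancelˡ-≡ k _ _ (ι-injective (begin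
      ι (k ℤ.* (A ℤ.- B))     ≡⟨ cong ι (k[a-b]≡ka-kb k A B) ⟩
      ι (k ℤ.* A ℤ.- k ℤ.* B) ≡⟨ ι-homo-sub (k ℤ.* A) (k ℤ.* B) ⟩
      κ a - κ b               ≡⟨ cong (_- κ b) (sym (c*ρ a)) ⟩
      ι c * ρ a - κ b         ≡⟨ sym (c*[y-ρ] (ρ a) b) ⟩
      ι c * (ρ a - ρ b)       ≡⟨ cong (ι c *_) ρa-ρb≡kz ⟩
      ι c * ι (k ℤ.* z)       ≡⟨ sym (ι-homo-* c (k ℤ.* z)) ⟩
      ι (c ℤ.* (k ℤ.* z))     ≡⟨ cong ι (c[kz]≡k[zc] c k z) ⟩
      ι (k ℤ.* (z ℤ.* c))     ∎))))
      where
      open ≡-Reasoning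
      A B : ℤ
      A = + toℕ a
      B = + toℕ b
      k[a-b]≡ka-kb : ∀ k a b → k ℤ.* (a ℤ.- b) ≡ k ℤ.* a ℤ.- k ℤ.* b
      k[a-b]≡ka-kb = solve 3 (λ k a b → k :* (a :- b) := k :* a :- k :* b) refl
        where open ℤ-Solver
      c[kz]≡k[zc] : ∀ c k z → c ℤ.* (k ℤ.* z) ≡ k ℤ.* (z ℤ.* c)
      c[kz]≡k[zc] = solve 3 (λ c k z → c :* (k :* z) := k :* (z :* c)) refl
        where open ℤ-Solver

    cover : ∀ {y} → Multiple k (ι c * y) → ∃ λ a → Multiple k (y - ρ a)
    cover {y} (K , cy≡kK) = a , q , *-cancelˡ-≡ _ _ ιc≢0 (begin
      ι c * (y - ρ a)                       ≡⟨ c*[y-ρ] y a ⟩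
      ι c * y - κ a                         ≡⟨ cong₂ _-_ cy≡kK (cong (λ r → ι (k ℤ.* + r)) toℕa≡K%c) ⟩
      ι (k ℤ.* K) - ι (k ℤ.* r)             ≡⟨ sym (ι-homo-sub (k ℤ.* K) (k ℤ.* r)) ⟩
      ι (k ℤ.* K ℤ.- k ℤ.* r)               ≡⟨ cong (λ t → ι (k ℤ.* t ℤ.- k ℤ.* r)) (a≡a%n+[a/n]*n K c) ⟩
      ι (k ℤ.* (r ℤ.+ q ℤ.* c) ℤ.- k ℤ.* r) ≡⟨ cong ι (k[r+qc]-kr≡c[kq] k c r q) ⟩
      ι (c ℤ.* (k ℤ.* q))                   ≡⟨ ι-homo-* c (k ℤ.* q) ⟩
      ι c * ι (k ℤ.* q)                     ∎)
      where
      open ≡-Reasoning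
      r q : ℤ
      r = + (K % c)
      q = K / c
      a : Fin ∣ c ∣
      a = Fin.fromℕ< (n%d<d K c)
      toℕa≡K%c : toℕ a ≡ K % c
      toℕa≡K%c = Fin.toℕ-fromℕ< (n%d<d K c)
      k[r+qc]-kr≡c[kq] : ∀ k c r q → k ℤ.* (r ℤ.+ q ℤ.* c) ℤ.- k ℤ.* r ≡ c ℤ.* (k ℤ.* q)
      k[r+qc]-kr≡c[kq] = solve 4 (λ k c r q → k :* (r :+ q :* c) :- k :* r := c :* (k :* q)) refl
        where open ℤ-Solver

  Index-IsInt-scaled : ∀ {c} → c ≢ + 0 → Index _-_ (λ y → IsInt (ι c * y)) IsInt ∣ c ∣
  Index-IsInt-scaled c≢0 =
    Index-cong (Multiple1⇒IsInt , IsInt⇒Multiple1) (Multiple1⇒IsInt , IsInt⇒Multiple1)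
               (Index-multiples {+ 1} (λ ()) c≢0)

  Index-IsInt-IsEvenInt : Index _-_ IsInt IsEvenInt 2
  Index-IsInt-IsEvenInt = Index-cong (halve , double) (id , id) (Index-multiples {+ 2} {+ 2} (λ ()) (λ ()))
    where
    halve : ∀ {y} → Multiple (+ 2) (ι (+ 2) * y) → IsInt y
    halve {y} (z , 2y≡2z) = z , *-cancelˡ-≡ {ι (+ 2)} y (ι z) (λ ()) (trans 2y≡2z (ι-homo-* (+ 2) z))
    double : ∀ {y} → IsInt y → Multiple (+ 2) (ι (+ 2) * y)
    double (z , refl) = z , sym (ι-homo-* (+ 2) z)

open Indices

module Polynomials where

  open import Data.Rational as ℚ using (ℚ; 0ℚ; 1ℚ; _+_; _*_; _-_; -_; 1/_)
  import Data.Rational.Properties as ℚP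
  open import Algebra.Properties.Group ℚP.+-0-group using (x∙y⁻¹≈ε⇒x≈y)
  open import Data.Rational.Solver using (module +-*-Solver)
  open import Data.Vec using (Vec; []; _∷_)
  open +-*-Solver

  eval-+ : ∀ {n} (f g : Vec ℚ n) x → eval (f +ₚ g) x ≡ eval f x + eval g x
  eval-+ []      []      x = refl
  eval-+ (a ∷ f) (b ∷ g) x rewrite eval-+ f g x =
    solve 5 (λ a b x F G → (a :+ b) :+ x :* (F :+ G) := (a :+ x :* F) :+ (b :+ x :* G))
      refl a b x (eval f x) (eval g x)

  eval-sub : ∀ {n} (f g : Vec ℚ n) x → eval (f -ₚ g) x ≡ eval f x - eval g x
  eval-sub []      []      x = refl
  eval-sub (a ∷ f) (b ∷ g) x rewrite eval-sub f g x =
    solve 5 (λ a b x F G → (a :- b) :+ x :* (F :- G) := (a :+ x :* F) :- (b :+ x :* G))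
      refl a b x (eval f x) (eval g x)

  eval-0 : ∀ {n} x → eval (0ₚ {n}) x ≡ 0ℚ
  eval-0 {zero}  x = refl
  eval-0 {suc n} x rewrite eval-0 {n} x = solve 1 (λ x → con 0ℚ :+ x :* con 0ℚ := con 0ℚ) refl x

  eval-· : ∀ {n} c (f : Vec ℚ n) x → eval (c ·ₚ f) x ≡ c * eval f x
  eval-· c []      x = sym (ℚP.*-zeroʳ c)
  eval-· c (a ∷ f) x rewrite eval-· c f x =
    solve 4 (λ c a x F → c :* a :+ x :* (c :* F) := c :* (a :+ x :* F)) refl c a x (eval f x)

  eval-additive : ∀ {n} x → IsAdditive (λ (f : Vec ℚ n) → eval f x)
  eval-additive {n} x = record
    { homo-0   = eval-0 {n} x
    ; homo-+   = λ f g → eval-+ f g x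
    ; homo-sub = λ f g → eval-sub f g x
    }

  const : ∀ {n} → ℚ → Vec ℚ (suc n)
  const c = c ∷ 0ₚ

  eval-const : ∀ {n} c x → eval (const {n} c) x ≡ c
  eval-const {n} c x rewrite eval-0 {n} x = solve 2 (λ c x → c :+ x :* con 0ℚ := c) refl c x

  mulLinear : ∀ {n} → ℚ → Vec ℚ n → Vec ℚ (suc n)
  mulLinear a []      = 0ℚ ∷ []
  mulLinear a (c ∷ f) = - (a * c) ∷ (const c +ₚ mulLinear a f)

  eval-mulLinear : ∀ {n} a (f : Vec ℚ n) x → eval (mulLinear a f) x ≡ (x - a) * eval f x
  eval-mulLinear a []      x = solve 2 (λ a x → con 0ℚ :+ x :* con 0ℚ := (x :- a) :* con 0ℚ) refl a x
  eval-mulLinear {suc n} a (c ∷ f) x = begin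
    - (a * c) + x * eval (const c +ₚ mulLinear a f) x
      ≡⟨ cong (λ t → - (a * c) + x * t) (trans (eval-+ (const c) (mulLinear a f) x)
                                               (cong₂ _+_ (eval-const {n} c x) (eval-mulLinear a f x))) ⟩
    - (a * c) + x * (c + (x - a) * eval f x)
      ≡⟨ solve 4 (λ a c x F → :- (a :* c) :+ x :* (c :+ (x :- a) :* F) := (x :- a) :* (c :+ x :* F))
                 refl a c x (eval f x) ⟩
    (x - a) * (c + x * eval f x) ∎
    where open ≡-Reasoning

  synthDiv : ∀ {n} → ℚ → Vec ℚ (suc n) → Vec ℚ n
  synthDiv {zero}  a (c ∷ [])  = []
  synthDiv {suc n} a (c ∷ f)   = eval f a ∷ synthDiv a f

  eval-synthDiv : ∀ {n} a (f : Vec ℚ (suc n)) x → eval f x ≡ eval f a + (x - a) * eval (synthDiv a f) x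
  eval-synthDiv {zero}  a (c ∷ []) x =
    solve 3 (λ a c x → c :+ x :* con 0ℚ := (c :+ a :* con 0ℚ) :+ (x :- a) :* con 0ℚ) refl a c x
  eval-synthDiv {suc n} a (c ∷ f)  x rewrite eval-synthDiv a f x =
    solve 5 (λ a c x F Q → c :+ x :* (F :+ (x :- a) :* Q) := (c :+ a :* F) :+ (x :- a) :* (F :+ x :* Q))
      refl a c x (eval f a) (eval (synthDiv a f) x)

  vanishing : ∀ {k} → (Fin k → ℚ) → Vec ℚ (suc k)
  vanishing {zero}  xs = 1ℚ ∷ []
  vanishing {suc k} xs = mulLinear (xs zero) (vanishing (xs ∘ suc))

  eval-vanishing-root : ∀ {k} (xs : Fin k → ℚ) j → eval (vanishing xs) (xs j) ≡ 0ℚ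
  eval-vanishing-root {suc k} xs j = trans (eval-mulLinear (xs zero) (vanishing (xs ∘ suc)) (xs j)) (vanishes j)
    where
    p : ℚ → ℚ
    p = eval (vanishing (xs ∘ suc))
    vanishes : ∀ j → (xs j - xs zero) * p (xs j) ≡ 0ℚ
    vanishes zero    = trans (cong (_* p (xs zero)) (ℚP.+-inverseʳ (xs zero))) (ℚP.*-zeroˡ (p (xs zero)))
    vanishes (suc j) = trans (cong ((xs (suc j) - xs zero) *_) (eval-vanishing-root (xs ∘ suc) j))
                             (ℚP.*-zeroʳ (xs (suc j) - xs zero))

  eval-vanishing-nonroot : ∀ {k} (xs : Fin k → ℚ) {x} → (∀ j → xs j ≢ x) → eval (vanishing xs) x ≢ 0ℚ
  eval-vanishing-nonroot {zero}  xs {x} _ eq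
    with () ← trans (sym (solve 1 (λ x → con 1ℚ :+ x :* con 0ℚ := con 1ℚ) refl x)) eq
  eval-vanishing-nonroot {suc k} xs {x} x∉ eq =
    eval-vanishing-nonroot (xs ∘ suc) (x∉ ∘ suc)
      (*-cancelˡ-≡ _ 0ℚ x-x₀≢0 (trans (sym (eval-mulLinear (xs zero) (vanishing (xs ∘ suc)) x))
                                     (trans eq (sym (ℚP.*-zeroʳ (x - xs zero))))))
    where
    x-x₀≢0 : x - xs zero ≢ 0ℚ
    x-x₀≢0 = x∉ zero ∘ sym ∘ x∙y⁻¹≈ε⇒x≈y x (xs zero)

  lagrangeBasis : ∀ {n} → (Fin n → ℚ) → Fin n → Vec ℚ n
  lagrangeBasis {suc m} xs i = vanishing (xs ∘ Fin.punchIn i)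

  eval-lagrangeBasis-≢ : ∀ {n} (xs : Fin n → ℚ) {i j} → i ≢ j → eval (lagrangeBasis xs j) (xs i) ≡ 0ℚ
  eval-lagrangeBasis-≢ {suc m} xs {i} {j} i≢j =
    subst (λ k → eval (lagrangeBasis xs j) (xs k) ≡ 0ℚ) (Fin.punchIn-punchOut j≢i)
          (eval-vanishing-root (xs ∘ Fin.punchIn j) (Fin.punchOut j≢i))
    where
    j≢i : j ≢ i
    j≢i = i≢j ∘ sym

  eval-lagrangeBasis-≡ : ∀ {n} {xs : Fin n → ℚ} → Injective _≡_ _≡_ xs →
                         ∀ i → eval (lagrangeBasis xs i) (xs i) ≢ 0ℚ
  eval-lagrangeBasis-≡ {suc m} {xs} xs-inj i =
    eval-vanishing-nonroot (xs ∘ Fin.punchIn i) (λ j eq → Fin.punchInᵢ≢i i j (xs-inj eq))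

  lagrangeCoordinates : ∀ {n} {xs : Fin n → ℚ} → Injective _≡_ _≡_ xs → Coordinates n
  lagrangeCoordinates {n} {xs} xs-inj = record
    { coord          = λ i f → eval f (xs i)
    ; coord-additive = eval-additive ∘ xs
    ; dual           = dual
    ; coord-dual-≡   = λ i q → trans (eval-· (q * v⁻¹ i) (lagrangeBasis xs i) (xs i)) (q*v⁻¹*v≡q i q)
    ; coord-dual-≢   = λ {i} {j} q i≢j → trans (eval-· (q * v⁻¹ j) (lagrangeBasis xs j) (xs i))
                         (trans (cong (q * v⁻¹ j *_) (eval-lagrangeBasis-≢ xs i≢j)) (ℚP.*-zeroʳ (q * v⁻¹ j)))
    }
    where
    v : Fin n → ℚ
    v i = eval (lagrangeBasis xs i) (xs i)
    v≢0 : ∀ i → ℚ.NonZero (v i)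
    v≢0 i = ℚ.≢-nonZero (eval-lagrangeBasis-≡ xs-inj i)
    v⁻¹ : Fin n → ℚ
    v⁻¹ i = 1/_ (v i) {{v≢0 i}}
    dual : Fin n → ℚ → Vec ℚ n
    dual i q = (q * v⁻¹ i) ·ₚ lagrangeBasis xs i
    q*v⁻¹*v≡q : ∀ i q → q * v⁻¹ i * v i ≡ q
    q*v⁻¹*v≡q i q = trans (ℚP.*-assoc q (v⁻¹ i) (v i))
                      (trans (cong (q *_) (ℚP.*-inverseˡ (v i) {{v≢0 i}})) (ℚP.*-identityʳ q))

open Polynomials

module FiniteDifferences where

  open import Data.Integer as ℤ using (ℤ; +_; -[1+_]; +[1+_])
  import Data.Integer.Properties as ℤP
  open import Data.Integer.Solver using () renaming (module +-*-Solver to ℤ-Solver)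
  open import Data.Rational as ℚ using (ℚ; 0ℚ; 1ℚ; _+_; _*_; _-_; 1/_)
  import Data.Rational.Properties as ℚP
  open import Data.Rational.Solver using (module +-*-Solver)
  open import Data.Vec using (Vec; []; _∷_)
  open import Data.Vec.Functional using (updateAt)
  open import Data.Vec.Functional.Properties using (updateAt-updates; updateAt-minimal)
  open +-*-Solver

  ℤ-induction : ∀ (Q : ℤ → Set) a → Q a → (∀ {m} → Q m → Q (ℤ.suc m)) → (∀ {m} → Q (ℤ.suc m) → Q m) →
                ∀ m → Q m
  ℤ-induction Q a Qa up down m = subst Q (m-a+a≡m m a) (from (m ℤ.- a))
    where
    m-a+a≡m : ∀ m a → m ℤ.- a ℤ.+ a ≡ m
    m-a+a≡m = ℤ-Solver.solve 2 (λ m a → m ℤ-Solver.:- a ℤ-Solver.:+ a ℤ-Solver.:= m) refl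
    from : ∀ k → Q (k ℤ.+ a)
    from (+ zero)      = subst Q (sym (ℤP.+-identityˡ a)) Qa
    from +[1+ k ]      = subst Q (sym (ℤP.suc-+ k a)) (up (from (+ k)))
    from -[1+ zero ]   = down (subst Q (trans (sym (ℤP.+-identityˡ a)) (ℤP.+-assoc (+ 1) -[1+ 0 ] a)) Qa)
    from -[1+ suc k ]  = down (subst Q (ℤP.+-assoc (+ 1) -[1+ suc k ] a) (from -[1+ k ]))

  Δ : (ℤ → ℚ) → ℤ → ℚ
  Δ φ m = φ (ℤ.suc m) - φ m

  Δ^ : ℕ → (ℤ → ℚ) → ℤ → ℚ
  Δ^ zero    φ = φ
  Δ^ (suc k) φ = Δ (Δ^ k φ)

  Δ^-cong : ∀ {φ ψ} k → φ ≗ ψ → Δ^ k φ ≗ Δ^ k ψ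
  Δ^-cong zero    φ≗ψ m = φ≗ψ m
  Δ^-cong (suc k) φ≗ψ m = cong₂ _-_ (Δ^-cong k φ≗ψ (ℤ.suc m)) (Δ^-cong k φ≗ψ m)

  Δ^-+ : ∀ k φ ψ m → Δ^ k (λ n → φ n + ψ n) m ≡ Δ^ k φ m + Δ^ k ψ m
  Δ^-+ zero    φ ψ m = refl
  Δ^-+ (suc k) φ ψ m rewrite Δ^-+ k φ ψ (ℤ.suc m) | Δ^-+ k φ ψ m =
    solve 4 (λ a b c d → (a :+ b) :- (c :+ d) := (a :- c) :+ (b :- d)) refl
      (Δ^ k φ (ℤ.suc m)) (Δ^ k ψ (ℤ.suc m)) (Δ^ k φ m) (Δ^ k ψ m)

  Δ^-sub : ∀ k φ ψ m → Δ^ k (λ n → φ n - ψ n) m ≡ Δ^ k φ m - Δ^ k ψ m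
  Δ^-sub zero    φ ψ m = refl
  Δ^-sub (suc k) φ ψ m rewrite Δ^-sub k φ ψ (ℤ.suc m) | Δ^-sub k φ ψ m =
    solve 4 (λ a b c d → (a :- b) :- (c :- d) := (a :- c) :- (b :- d)) refl
      (Δ^ k φ (ℤ.suc m)) (Δ^ k ψ (ℤ.suc m)) (Δ^ k φ m) (Δ^ k ψ m)

  Δ^-const : ∀ k c m → Δ^ (suc k) (λ _ → c) m ≡ 0ℚ
  Δ^-const zero    c m = ℚP.+-inverseʳ c
  Δ^-const (suc k) c m rewrite Δ^-const k c (ℤ.suc m) | Δ^-const k c m = refl

  Δ^-0 : ∀ k m → Δ^ k (λ _ → 0ℚ) m ≡ 0ℚ
  Δ^-0 zero    m = refl
  Δ^-0 (suc k) m = Δ^-const k 0ℚ m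

  Δ^-Δ : ∀ k φ m → Δ^ k (Δ φ) m ≡ Δ^ (suc k) φ m
  Δ^-Δ zero    φ m = refl
  Δ^-Δ (suc k) φ m = cong₂ _-_ (Δ^-Δ k φ (ℤ.suc m)) (Δ^-Δ k φ m)

  ι-suc : ∀ m → ι (ℤ.suc m) ≡ 1ℚ + ι m
  ι-suc = ι-homo-+ (+ 1)

  Δ^-leibniz : ∀ k φ a m → Δ^ (suc k) (λ n → (ι n - a) * φ n) m ≡
                           ι (+ suc k) * Δ^ k φ (ℤ.suc m) + (ι m - a) * Δ^ (suc k) φ m
  Δ^-leibniz zero φ a m rewrite ι-suc m =
    solve 4 (λ x a p q → ((con 1ℚ :+ x) :- a) :* p :- (x :- a) :* q := con 1ℚ :* p :+ (x :- a) :* (p :- q))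
      refl (ι m) a (φ (ℤ.suc m)) (φ m)
  Δ^-leibniz (suc k) φ a m
    rewrite Δ^-leibniz k φ a (ℤ.suc m) | Δ^-leibniz k φ a m | ι-suc m | ι-suc (+ suc k) =
    solve 6 (λ K x a p q r →
      (K :* p :+ ((con 1ℚ :+ x) :- a) :* (p :- q)) :- (K :* q :+ (x :- a) :* r)
        := (con 1ℚ :+ K) :* (p :- q) :+ (x :- a) :* ((p :- q) :- r))
      refl (ι (+ suc k)) (ι m) a (Δ^ k φ (ℤ.suc (ℤ.suc m))) (Δ^ k φ (ℤ.suc m)) (Δ^ (suc k) φ m)

  Δ^-leibniz-at : ∀ k φ a → Δ^ (suc k) (λ n → (ι n - ι a) * φ n) a ≡ ι (+ suc k) * Δ^ k φ (ℤ.suc a)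
  Δ^-leibniz-at k φ a = trans (Δ^-leibniz k φ (ι a) a)
    (solve 3 (λ p x r → p :+ (x :- x) :* r := p) refl
       (ι (+ suc k) * Δ^ k φ (ℤ.suc a)) (ι a) (Δ^ (suc k) φ a))

  Δ^-eval-vanishes : ∀ {n} (f : Vec ℚ n) m → Δ^ n (eval f ∘ ι) m ≡ 0ℚ
  Δ^-eval-vanishes []              m = refl
  Δ^-eval-vanishes {suc n} (c ∷ g) m = begin
    Δ^ (suc n) (eval (c ∷ g) ∘ ι) m
      ≡⟨ Δ^-cong (suc n) (λ k → cong (_+_ c) (cong (_* G k) (sym (ℚP.+-identityʳ (ι k))))) m ⟩
    Δ^ (suc n) (λ k → c + (ι k - 0ℚ) * G k) m
      ≡⟨ Δ^-+ (suc n) (λ _ → c) (λ k → (ι k - 0ℚ) * G k) m ⟩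
    Δ^ (suc n) (λ _ → c) m + Δ^ (suc n) (λ k → (ι k - 0ℚ) * G k) m
      ≡⟨ cong₂ _+_ (Δ^-const n c m) (Δ^-leibniz n G 0ℚ m) ⟩
    0ℚ + (ι (+ suc n) * Δ^ n G (ℤ.suc m) + (ι m - 0ℚ) * (Δ^ n G (ℤ.suc m) - Δ^ n G m))
      ≡⟨ cong₂ (λ u w → 0ℚ + (ι (+ suc n) * u + (ι m - 0ℚ) * (u - w)))
               (Δ^-eval-vanishes g (ℤ.suc m)) (Δ^-eval-vanishes g m) ⟩
    0ℚ + (ι (+ suc n) * 0ℚ + (ι m - 0ℚ) * (0ℚ - 0ℚ))
      ≡⟨ solve 2 (λ K x → con 0ℚ :+ (K :* con 0ℚ :+ x :* (con 0ℚ :- con 0ℚ)) := con 0ℚ)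
                 refl (ι (+ suc n)) (ι m - 0ℚ) ⟩
    0ℚ ∎
    where
    open ≡-Reasoning
    G : ℤ → ℚ
    G = eval g ∘ ι

  module _ {P : Pred ℚ 0ℓ} (P-sub : IsSubgroupℚ P) where

    Δ^-preserves : ∀ {φ} → (∀ m → P (φ m)) → ∀ k m → P (Δ^ k φ m)
    Δ^-preserves Pφ zero    m = Pφ m
    Δ^-preserves Pφ (suc k) m = -∈ P-sub (Δ^-preserves Pφ k (ℤ.suc m)) (Δ^-preserves Pφ k m)

    Δ^-reflects : ∀ n {φ} a → (∀ m → Δ^ n φ m ≡ 0ℚ) → (∀ (j : Fin n) → P (Δ^ (toℕ j) φ a)) →
                  ∀ m → P (φ m)
    Δ^-reflects zero    {φ} a Δⁿφ≡0 _    m = subst P (sym (Δⁿφ≡0 m)) (0∈ P-sub)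
    Δ^-reflects (suc n) {φ} a Δⁿφ≡0 PΔʲφ = ℤ-induction (P ∘ φ) a (PΔʲφ zero) up down
      where
      PΔφ : ∀ m → P (Δ φ m)
      PΔφ = Δ^-reflects n a (λ m → trans (Δ^-Δ n φ m) (Δⁿφ≡0 m))
                            (λ j → subst P (sym (Δ^-Δ (toℕ j) φ a)) (PΔʲφ (suc j)))
      up : ∀ {m} → P (φ m) → P (φ (ℤ.suc m))
      up {m} Pφm = subst P (solve 2 (λ x y → x :+ (y :- x) := y) refl (φ m) (φ (ℤ.suc m)))
                           (+∈ P-sub Pφm (PΔφ m))
      down : ∀ {m} → P (φ (ℤ.suc m)) → P (φ m)
      down {m} Pφm′ = subst P (solve 2 (λ x y → y :- (y :- x) := x) refl (φ m) (φ (ℤ.suc m)))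
                              (-∈ P-sub Pφm′ (PΔφ m))

  ι-suc≢0 : ∀ k → ι (+ suc k) ≢ 0ℚ
  ι-suc≢0 k eq with () ← ι-injective {+ suc k} {+ 0} eq

  1/suc : ℕ → ℚ
  1/suc k = 1/_ (ι (+ suc k)) {{ℚ.≢-nonZero (ι-suc≢0 k)}}

  newton-tail : ∀ {n} → (Fin (suc n) → ℚ) → Fin n → ℚ
  newton-tail c j = c (suc j) * 1/suc (toℕ j)

  -- c₀ + (X − a)·q has differences c at a as soon as q has differences c_{j+1}/(j+1) at a + 1,
  -- by Δ^-leibniz-at.
  newton : ∀ {n} → ℤ → (Fin n → ℚ) → Vec ℚ n
  newton {zero}  a c = []
  newton {suc n} a c = const (c zero) +ₚ mulLinear (ι a) (newton (ℤ.suc a) (newton-tail c))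

  eval-newton : ∀ {n} a (c : Fin (suc n) → ℚ) m →
                eval (newton a c) (ι m) ≡ c zero + (ι m - ι a) * eval (newton (ℤ.suc a) (newton-tail c)) (ι m)
  eval-newton {n} a c m =
    let q = newton (ℤ.suc a) (newton-tail c) in
    trans (eval-+ (const (c zero)) (mulLinear (ι a) q) (ι m))
          (cong₂ _+_ (eval-const {n} (c zero) (ι m)) (eval-mulLinear (ι a) q (ι m)))

  Δ^-newton : ∀ {n} a (c : Fin n → ℚ) j → Δ^ (toℕ j) (eval (newton a c) ∘ ι) a ≡ c j
  Δ^-newton {suc n} a c zero =
    trans (eval-newton a c a) (solve 3 (λ c x q → c :+ (x :- x) :* q := c) refl (c zero) (ι a) (Q a))
    where
    Q : ℤ → ℚ
    Q = eval (newton (ℤ.suc a) (newton-tail c)) ∘ ι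
  Δ^-newton {suc n} a c (suc j) = begin
    Δ^ (suc k) (eval (newton a c) ∘ ι) a
      ≡⟨ Δ^-cong (suc k) (eval-newton a c) a ⟩
    Δ^ (suc k) (λ m → c zero + (ι m - ι a) * Q m) a
      ≡⟨ Δ^-+ (suc k) (λ _ → c zero) (λ m → (ι m - ι a) * Q m) a ⟩
    Δ^ (suc k) (λ _ → c zero) a + Δ^ (suc k) (λ m → (ι m - ι a) * Q m) a
      ≡⟨ cong₂ _+_ (Δ^-const k (c zero) a) (Δ^-leibniz-at k Q a) ⟩
    0ℚ + ι (+ suc k) * Δ^ k Q (ℤ.suc a)
      ≡⟨ cong (λ t → 0ℚ + ι (+ suc k) * t) (Δ^-newton (ℤ.suc a) (newton-tail c) j) ⟩
    0ℚ + ι (+ suc k) * (c (suc j) * 1/suc k)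
      ≡⟨ solve 3 (λ K x r → con 0ℚ :+ K :* (x :* r) := x :* (K :* r)) refl
                 (ι (+ suc k)) (c (suc j)) (1/suc k) ⟩
    c (suc j) * (ι (+ suc k) * 1/suc k)
      ≡⟨ cong (c (suc j) *_) (ℚP.*-inverseʳ (ι (+ suc k)) {{ℚ.≢-nonZero (ι-suc≢0 k)}}) ⟩
    c (suc j) * 1ℚ
      ≡⟨ ℚP.*-identityʳ (c (suc j)) ⟩
    c (suc j) ∎
    where
    open ≡-Reasoning
    k : ℕ
    k = toℕ j
    Q : ℤ → ℚ
    Q = eval (newton (ℤ.suc a) (newton-tail c)) ∘ ι

  Δ^-eval-additive : ∀ {n} k b → IsAdditive (λ (f : Vec ℚ n) → Δ^ k (eval f ∘ ι) b)
  Δ^-eval-additive {n} k b = record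
    { homo-0   = trans (Δ^-cong k (eval-0 {n} ∘ ι) b) (Δ^-0 k b)
    ; homo-+   = λ f g → trans (Δ^-cong k (eval-+ f g ∘ ι) b) (Δ^-+ k (eval f ∘ ι) (eval g ∘ ι) b)
    ; homo-sub = λ f g → trans (Δ^-cong k (eval-sub f g ∘ ι) b) (Δ^-sub k (eval f ∘ ι) (eval g ∘ ι) b)
    }

  newtonCoordinates : ∀ {n} → ℤ → Coordinates {n} n
  newtonCoordinates b = record
    { coord          = λ j f → Δ^ (toℕ j) (eval f ∘ ι) b
    ; coord-additive = λ j → Δ^-eval-additive (toℕ j) b
    ; dual           = λ j q → newton b (updateAt (λ _ → 0ℚ) j (λ _ → q))
    ; coord-dual-≡   = λ j q → trans (Δ^-newton b _ j) (updateAt-updates j (λ _ → 0ℚ))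
    ; coord-dual-≢   = λ {i} {j} q i≢j → trans (Δ^-newton b _ i) (updateAt-minimal i j (λ _ → 0ℚ) i≢j)
    }

open FiniteDifferences

module Products where

  open import Data.Bool using (if_then_else_)
  open import Data.Integer as ℤ using (ℤ; ∣_∣)
  import Data.Integer.Properties as ℤP
  open import Data.List using (List; []; _∷_; map; concatMap; tabulate; allFin; upTo; _∷ʳ_)
  import Data.List.Properties as List
  open import Data.Nat using (_*_; _!)
  open import Algebra.Properties.CommutativeMonoid.Sum ℕP.*-1-commutativeMonoid using ()
    renaming (∑-distrib-+ to ∏-distrib-*; sum-cong-≗ to ∏-cong; sum-init-last to ∏-init-last)
  open import Data.Nat.ListAction using (product)
  open import Data.Nat.ListAction.Properties using (product-++)
  open import Data.Nat.Solver using (module +-*-Solver)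
  open import Data.Vec using (Vec; _∷_; lookup)
  open ≡-Reasoning

  ∏-suc-toℕ : ∀ n → ∏ (λ (j : Fin n) → suc (toℕ j)) ≡ n !
  ∏-suc-toℕ zero    = refl
  ∏-suc-toℕ (suc n) = begin
    ∏ {suc n} (suc ∘ toℕ)
      ≡⟨ ∏-init-last {n} (suc ∘ toℕ) ⟩
    ∏ {n} (suc ∘ toℕ ∘ Fin.inject₁) * suc (toℕ (Fin.fromℕ n))
      ≡⟨ cong₂ _*_ (∏-cong {n} (cong suc ∘ Fin.toℕ-inject₁)) (cong suc (Fin.toℕ-fromℕ n)) ⟩
    ∏ {n} (suc ∘ toℕ) * suc n
      ≡⟨ cong (_* suc n) (∏-suc-toℕ n) ⟩
    n ! * suc n
      ≡⟨ ℕP.*-comm (n !) (suc n) ⟩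
    suc n ! ∎

  superfactorial : ℕ → ℕ
  superfactorial zero    = 1
  superfactorial (suc n) = superfactorial n * n !

  superfact≡superfactorial : ∀ d → superfact d ≡ superfactorial (suc d)
  superfact≡superfactorial zero    = refl
  superfact≡superfactorial (suc d) = begin
    product (map h (upTo (suc d)))       ≡⟨ cong (product ∘ map h) (sym (List.upTo-∷ʳ d)) ⟩
    product (map h (upTo d ∷ʳ d))        ≡⟨ cong product (List.map-++ h (upTo d) (d ∷ [])) ⟩
    product (map h (upTo d) ∷ʳ h d)      ≡⟨ product-++ (map h (upTo d)) (h d ∷ []) ⟩
    product (map h (upTo d)) * (h d * 1) ≡⟨ cong₂ _*_ (superfact≡superfactorial d) (ℕP.*-identityʳ (h d)) ⟩
    superfactorial (suc d) * suc d !     ∎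
    where
    h : ℕ → ℕ
    h k = suc k !

  gap : ℤ → ℤ → ℕ
  gap x y = if does (y ℤP.<? x) then ∣ x ℤ.- y ∣ else 1

  gap-refl : ∀ x → gap x x ≡ 1
  gap-refl x with x ℤP.<? x
  ... | yes x<x = ⊥-elim (ℤP.<-irrefl refl x<x)
  ... | no _    = refl

  gap-swap : ∀ {x y} → x ≢ y → gap y x * gap x y ≡ ∣ x ℤ.- y ∣
  gap-swap {x} {y} x≢y with x ℤP.<? y | y ℤP.<? x
  ... | yes x<y | yes y<x = ⊥-elim (ℤP.<-asym x<y y<x)
  ... | yes _   | no _    = trans (ℕP.*-identityʳ _) (ℤP.∣i-j∣≡∣j-i∣ y x)
  ... | no _    | yes _   = ℕP.*-identityˡ _
  ... | no x≮y  | no y≮x  = ⊥-elim (x≢y (ℤP.≤-antisym (ℤP.≮⇒≥ y≮x) (ℤP.≮⇒≥ x≮y)))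

  product-tabulate : ∀ {n} (g : Fin n → ℕ) → product (tabulate g) ≡ ∏ g
  product-tabulate {zero}  g = refl
  product-tabulate {suc n} g = cong (g zero *_) (product-tabulate (g ∘ suc))

  product-map-allFin : ∀ {n} (g : Fin n → ℕ) → product (map g (allFin n)) ≡ ∏ g
  product-map-allFin g = trans (cong product (List.map-tabulate id g)) (product-tabulate g)

  product-concatMap : ∀ {A : Set} (f : A → List ℕ) xs →
                      product (concatMap f xs) ≡ product (map (product ∘ f) xs)
  product-concatMap f []       = refl
  product-concatMap f (x ∷ xs) =
    trans (product-++ (f x) (concatMap f xs)) (cong (product (f x) *_) (product-concatMap f xs))

  diffProd≡∏∏ : ∀ {n} (S : Vec ℤ n) → diffProd S ≡ ∏ λ i → ∏ λ j → gap (lookup S i) (lookup S j)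
  diffProd≡∏∏ {n} S = begin
    diffProd S
      ≡⟨ product-concatMap (λ i → map (row i) (allFin n)) (allFin n) ⟩
    product (map (λ i → product (map (row i) (allFin n))) (allFin n))
      ≡⟨ product-map-allFin (λ i → product (map (row i) (allFin n))) ⟩
    ∏ (λ i → product (map (row i) (allFin n)))
      ≡⟨ ∏-cong (product-map-allFin ∘ row) ⟩
    ∏ (λ i → ∏ (row i)) ∎
    where
    row : Fin n → Fin n → ℕ
    row i j = gap (lookup S i) (lookup S j)

  diffProd-∷ : ∀ {n} s (S : Vec ℤ n) → (∀ i → lookup S i ≢ s) →
               diffProd (s ∷ S) ≡ ∏ (λ i → ∣ lookup S i ℤ.- s ∣) * diffProd S
  diffProd-∷ {n} s S s∉S = begin
    diffProd (s ∷ S)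
      ≡⟨ diffProd≡∏∏ (s ∷ S) ⟩
    gap s s * A * ∏ (λ i → gap (S! i) s * row (S! i))
      ≡⟨ cong₂ (λ g D → g * A * D) (gap-refl s) (∏-distrib-* (λ i → gap (S! i) s) (row ∘ S!)) ⟩
    (1 * A) * (B * D)
      ≡⟨ solve 3 (λ A B D → (con 1 :* A) :* (B :* D) := (A :* B) :* D) refl A B D ⟩
    (A * B) * D
      ≡⟨ cong₂ _*_ (sym (∏-distrib-* (λ i → gap s (S! i)) (λ i → gap (S! i) s))) (sym (diffProd≡∏∏ S)) ⟩
    ∏ (λ i → gap s (S! i) * gap (S! i) s) * diffProd S
      ≡⟨ cong (_* diffProd S) (∏-cong (gap-swap ∘ s∉S)) ⟩
    ∏ (λ i → ∣ S! i ℤ.- s ∣) * diffProd S ∎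
    where
    open +-*-Solver
    S! : Fin n → ℤ
    S! = lookup S
    row : ℤ → ℕ
    row x = ∏ λ j → gap x (S! j)
    A B D : ℕ
    A = row s
    B = ∏ λ i → gap (S! i) s
    D = ∏ λ i → row (S! i)

open Products

module IndexFormula where

  open import Data.Integer as ℤ using (ℤ; +_; ∣_∣)
  import Data.Integer.Properties as ℤP
  open import Data.Nat using (_!)
  open import Data.Rational as ℚ using (ℚ; 0ℚ; _+_; _*_; _-_)
  open import Data.Vec using (Vec; _∷_; lookup)
  open import Relation.Nullary.Decidable using (map′)
  open import Data.Rational.Solver using (module +-*-Solver)

  -- A_S and H of the paper for any number of coefficients; InA and InH are the case n = d + 1.
  IntValuedOn : ∀ {k n} → Vec ℤ k → Pred (Vec ℚ n) 0ℓ
  IntValuedOn {k} S = ⋂ (Fin k) λ i → (λ f → eval f (ι (lookup S i))) ⊢ IsInt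

  EvenValued : ∀ {n} → Pred (Vec ℚ n) 0ℓ
  EvenValued = ⋂ ℤ λ m → (λ f → eval f (ι m)) ⊢ IsEvenInt

  IntValuedOn-isSubgroup : ∀ {k n} (S : Vec ℤ k) → IsSubgroupᵥ n (IntValuedOn S)
  IntValuedOn-isSubgroup S = ⋂-isSubgroup λ i → preimage-isSubgroup (eval-additive _) IsInt-isSubgroup

  EvenValued-isSubgroup : ∀ {n} → IsSubgroupᵥ n EvenValued
  EvenValued-isSubgroup = ⋂-isSubgroup λ m → preimage-isSubgroup (eval-additive _) IsEvenInt-isSubgroup

  EvenValued⊆IntValuedOn : ∀ {k n} (S : Vec ℤ k) → EvenValued {n} ⊆′ IntValuedOn S
  EvenValued⊆IntValuedOn S _ even i = IsEvenInt⇒IsInt (even (lookup S i))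

  EvenValued≐Δ^ : ∀ {n} a → EvenValued {n} ≐ ⋂ (Fin n) λ j → (λ f → Δ^ (toℕ j) (eval f ∘ ι) a) ⊢ IsEvenInt
  EvenValued≐Δ^ {n} a =
    (λ even j → Δ^-preserves IsEvenInt-isSubgroup even (toℕ j) a) ,
    (λ {f} Δ^f-even → Δ^-reflects IsEvenInt-isSubgroup n a (Δ^-eval-vanishes f) Δ^f-even)

  Distinct-tail : ∀ {n s} {S : Vec ℤ n} → Distinct (s ∷ S) → Distinct S
  Distinct-tail distinct i j = Fin.suc-injective ∘ distinct (suc i) (suc j)

  Distinct-head : ∀ {n s} {S : Vec ℤ n} → Distinct (s ∷ S) → ∀ i → lookup S i ≢ s
  Distinct-head distinct i eq with () ← distinct (suc i) zero eq

  module Step {n} (s : ℤ) (S : Vec ℤ n) (S-distinct : Distinct S) (s∉S : ∀ i → lookup S i ≢ s) where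

    K : Pred (Vec ℚ (suc n)) 0ℓ
    K = IntValuedOn S ∩ (λ f → eval f (ι s)) ⊢ IsEvenInt

    B : Pred (Vec ℚ n) 0ℓ
    B = ⋂ (Fin n) λ i → (λ g → eval g (ι (lookup S i))) ⊢ λ y → IsInt (ι (lookup S i ℤ.- s) * y)

    φ : Vec ℚ n → Vec ℚ (suc n)
    φ = mulLinear (ι s)

    J : Pred (Vec ℚ n) 0ℓ
    J = φ ⊢ EvenValued

    eval-φ : ∀ g x → eval (φ g) x ≡ (x - ι s) * eval g x
    eval-φ = eval-mulLinear (ι s)

    eval-φ-ι : ∀ g m → eval (φ g) (ι m) ≡ ι (m ℤ.- s) * eval g (ι m)
    eval-φ-ι g m = trans (eval-φ g (ι m)) (cong (_* eval g (ι m)) (sym (ι-homo-sub m s)))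

    eval-φ-at-s : ∀ g → eval (φ g) (ι s) ≡ 0ℚ
    eval-φ-at-s g = trans (eval-φ g (ι s)) (solve 2 (λ x u → (x :- x) :* u := con 0ℚ) refl (ι s) (eval g (ι s)))
      where open +-*-Solver

    eval-φ-sub : ∀ g h x → eval (φ g -ₚ φ h) x ≡ eval (φ (g -ₚ h)) x
    eval-φ-sub g h x = begin
      eval (φ g -ₚ φ h) x                         ≡⟨ eval-sub (φ g) (φ h) x ⟩
      eval (φ g) x - eval (φ h) x                 ≡⟨ cong₂ _-_ (eval-φ g x) (eval-φ h x) ⟩
      (x - ι s) * eval g x - (x - ι s) * eval h x ≡⟨ cu-cv≡c[u-v] (x - ι s) (eval g x) (eval h x) ⟩
      (x - ι s) * (eval g x - eval h x)           ≡⟨ cong ((x - ι s) *_) (sym (eval-sub g h x)) ⟩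
      (x - ι s) * eval (g -ₚ h) x                 ≡⟨ sym (eval-φ (g -ₚ h) x) ⟩
      eval (φ (g -ₚ h)) x                         ∎
      where
      open ≡-Reasoning
      cu-cv≡c[u-v] : ∀ c u v → c * u - c * v ≡ c * (u - v)
      cu-cv≡c[u-v] = solve 3 (λ c u v → c :* u :- c :* v := c :* (u :- v)) refl
        where open +-*-Solver

    K-isSubgroup : IsSubgroupᵥ (suc n) K
    K-isSubgroup = ∩-isSubgroup (IntValuedOn-isSubgroup {n = suc n} S)
                                (preimage-isSubgroup (eval-additive (ι s)) IsEvenInt-isSubgroup)

    B-isSubgroup : IsSubgroupᵥ n B
    B-isSubgroup = ⋂-isSubgroup λ i → preimage-isSubgroup (eval-additive (ι (lookup S i)))
                                        (scaled-isSubgroup (ι (lookup S i ℤ.- s)) IsInt-isSubgroup)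

    K⊆IntValuedOn : K ⊆′ IntValuedOn (s ∷ S)
    K⊆IntValuedOn _ (ints , even) = Fin.∀-cons (IsEvenInt⇒IsInt even) ints

    EvenValued⊆K : EvenValued ⊆′ K
    EvenValued⊆K f even = EvenValued⊆IntValuedOn S f even , even s

    IntValuedOn⊆B : IntValuedOn S ⊆′ B
    IntValuedOn⊆B _ ints i = IsInt-scaled (lookup S i ℤ.- s) _ (ints i)

    EvenValued⊆J : EvenValued ⊆′ J
    EvenValued⊆J g even m = subst IsEvenInt (sym (eval-φ-ι g m)) (Multiple-scaled {+ 2} (m ℤ.- s) _ (even m))

    J⊆B : J ⊆′ B
    J⊆B g g∈J i = subst IsInt (eval-φ-ι g (lookup S i)) (IsEvenInt⇒IsInt (g∈J (lookup S i)))

    Index-A/K : Indexᵥ (IntValuedOn (s ∷ S)) K 2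
    Index-A/K =
      Index-cong ((λ (ints , int) → Fin.∀-cons int ints) , (λ ints → ints ∘ suc , ints zero)) (id , id)
        (Index-one-step (λ f → eval f (ι s)) const (IntValuedOn-isSubgroup S) (eval-additive (ι s))
          (λ q → eval-const {n} q (ι s))
          (λ {q} q∈ℤ i → subst IsInt (sym (eval-const {n} q (ι (lookup S i)))) q∈ℤ)
          Index-IsInt-IsEvenInt)

    Index-K/H : ∀ {M} → Indexᵥ B J M → Indexᵥ K EvenValued M
    Index-K/H = Index-transfer φ (λ {g} → φ∈K {g}) (λ {g} {h} → φ-reflects {g} {h}) (λ {f} → lift {f})
      where
      φ∈K : ∀ {g} → B g → K (φ g)
      φ∈K {g} g∈B = (λ i → subst IsInt (sym (eval-φ-ι g (lookup S i))) (g∈B i)) ,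
                    subst IsEvenInt (sym (eval-φ-at-s g)) (0∈ IsEvenInt-isSubgroup)

      φ-reflects : ∀ {g h} → EvenValued (φ g -ₚ φ h) → J (g -ₚ h)
      φ-reflects {g} {h} even m = subst IsEvenInt (eval-φ-sub g h (ι m)) (even m)

      -- f = f(s) + (X − s)·q with q ∈ B, and the constant f(s) is even.
      lift : ∀ {f} → K f → ∃ λ g → B g × (∀ {h} → J (g -ₚ h) → EvenValued (f -ₚ φ h))
      lift {f} (ints , f[s]-even) =
        q , q∈B , λ {h} q-h∈J m →
          subst IsEvenInt (sym (split h (ι m))) (+∈ IsEvenInt-isSubgroup f[s]-even (q-h∈J m))
        where
        open +-*-Solver
        q : Vec ℚ n
        q = synthDiv (ι s) f

        q∈B : B q
        q∈B i = subst IsInt (trans (difference (ι (lookup S i)))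
                                   (cong (_* eval q (ι (lookup S i))) (sym (ι-homo-sub (lookup S i) s))))
                        (-∈ IsInt-isSubgroup (ints i) (IsEvenInt⇒IsInt f[s]-even))
          where
          difference : ∀ x → eval f x - eval f (ι s) ≡ (x - ι s) * eval q x
          difference x = trans (cong (_- eval f (ι s)) (eval-synthDiv (ι s) f x))
                               (solve 2 (λ a b → (a :+ b) :- a := b) refl (eval f (ι s)) ((x - ι s) * eval q x))

        split : ∀ h x → eval (f -ₚ φ h) x ≡ eval f (ι s) + eval (φ (q -ₚ h)) x
        split h x = begin
          eval (f -ₚ φ h) x
            ≡⟨ eval-sub f (φ h) x ⟩
          eval f x - eval (φ h) x
            ≡⟨ cong (_- eval (φ h) x) (eval-synthDiv (ι s) f x) ⟩
          eval f (ι s) + (x - ι s) * eval q x - eval (φ h) x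
            ≡⟨ cong (λ t → eval f (ι s) + t - eval (φ h) x) (sym (eval-φ q x)) ⟩
          eval f (ι s) + eval (φ q) x - eval (φ h) x
            ≡⟨ solve 3 (λ a u v → a :+ u :- v := a :+ (u :- v)) refl (eval f (ι s)) (eval (φ q) x) (eval (φ h) x) ⟩
          eval f (ι s) + (eval (φ q) x - eval (φ h) x)
            ≡⟨ cong (_+_ (eval f (ι s))) (trans (sym (eval-sub (φ q) (φ h) x)) (eval-φ-sub q h x)) ⟩
          eval f (ι s) + eval (φ (q -ₚ h)) x ∎
          where open ≡-Reasoning

    Index-B/A : Indexᵥ B (IntValuedOn S) (∏ λ i → ∣ lookup S i ℤ.- s ∣)
    Index-B/A = Index-coordinates (lagrangeCoordinates ι∘S-injective)
                  (λ i → scaled-isSubgroup (ι (lookup S i ℤ.- s)) IsInt-isSubgroup) (λ _ → IsInt-isSubgroup)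
                  (λ i → IsInt-scaled (lookup S i ℤ.- s))
                  (λ i → Index-IsInt-scaled (s∉S i ∘ ℤP.i-j≡0⇒i≡j _ _))
      where
      ι∘S-injective : Injective _≡_ _≡_ (ι ∘ lookup S)
      ι∘S-injective = S-distinct _ _ ∘ ι-injective

    Δ^-φ-at-s : ∀ g k → Δ^ (suc k) (eval (φ g) ∘ ι) s ≡ ι (+ suc k) * Δ^ k (eval g ∘ ι) (ℤ.suc s)
    Δ^-φ-at-s g k = trans (Δ^-cong (suc k) (eval-φ g ∘ ι) s) (Δ^-leibniz-at k (eval g ∘ ι) s)

    NewtonJ : Pred (Vec ℚ n) 0ℓ
    NewtonJ = ⋂ (Fin n) λ j →
      (λ g → Δ^ (toℕ j) (eval g ∘ ι) (ℤ.suc s)) ⊢ λ y → IsEvenInt (ι (+ suc (toℕ j)) * y)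

    -- (X − s)·g vanishes at s, and Δ^{j+1}((X − s)·g)(s) = (j + 1)·Δʲg(s + 1).
    NewtonJ≐J : NewtonJ ≐ J
    NewtonJ≐J =
      (λ {g} coords → proj₂ (EvenValued≐Δ^ s) {φ g}
         (Fin.∀-cons (subst IsEvenInt (sym (eval-φ-at-s g)) (0∈ IsEvenInt-isSubgroup))
                     λ j → subst IsEvenInt (sym (Δ^-φ-at-s g (toℕ j))) (coords j))) ,
      (λ {g} g∈J j → subst IsEvenInt (Δ^-φ-at-s g (toℕ j)) (proj₁ (EvenValued≐Δ^ s) {φ g} g∈J (suc j)))

    J-isSubgroup : IsSubgroupᵥ n J
    J-isSubgroup = isSubgroup-resp-≐ NewtonJ≐J (⋂-isSubgroup λ j →
      preimage-isSubgroup (Δ^-eval-additive (toℕ j) (ℤ.suc s))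
                          (scaled-isSubgroup (ι (+ suc (toℕ j))) IsEvenInt-isSubgroup))

    J? : Decidable J
    J? g = map′ (proj₁ NewtonJ≐J {g}) (proj₂ NewtonJ≐J {g})
      (Fin.all? λ j → multiple? (+ 2) (ι (+ suc (toℕ j)) * Δ^ (toℕ j) (eval g ∘ ι) (ℤ.suc s)))

    Index-J/H : Indexᵥ J EvenValued (n !)
    Index-J/H = subst (Indexᵥ J EvenValued) (∏-suc-toℕ n)
      (Index-cong NewtonJ≐J (≐-sym (EvenValued≐Δ^ (ℤ.suc s)))
        (Index-coordinates (newtonCoordinates (ℤ.suc s))
          (λ j → scaled-isSubgroup (ι (+ suc (toℕ j))) IsEvenInt-isSubgroup) (λ _ → IsEvenInt-isSubgroup)
          (λ j → Multiple-scaled {+ 2} (+ suc (toℕ j)))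
          (λ j → Index-multiples {+ 2} {+ suc (toℕ j)} (λ ()) (λ ()))))

    index-step : ∀ {m} → Indexᵥ (IntValuedOn S) EvenValued m →
                 ∃ λ M → Indexᵥ (IntValuedOn (s ∷ S)) EvenValued (2 ℕ.* M) ×
                         M ℕ.* n ! ≡ (∏ λ i → ∣ lookup S i ℤ.- s ∣) ℕ.* m
    index-step {m} A/H = M , A/H′ , Index-unique EvenValued-isSubgroup B/H′ B/H
      where
      B/H : Indexᵥ B EvenValued ((∏ λ i → ∣ lookup S i ℤ.- s ∣) ℕ.* m)
      B/H = Index-* Index-B/A A/H B-isSubgroup (IntValuedOn-isSubgroup S) IntValuedOn⊆B (EvenValued⊆IntValuedOn S)
      M : ℕ
      M = proj₁ (Index-coarsen J-isSubgroup J? EvenValued⊆J B/H)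
      B/J : Indexᵥ B J M
      B/J = proj₂ (Index-coarsen J-isSubgroup J? EvenValued⊆J B/H)
      B/H′ : Indexᵥ B EvenValued (M ℕ.* n !)
      B/H′ = Index-* B/J Index-J/H B-isSubgroup J-isSubgroup J⊆B EvenValued⊆J
      A/H′ : Indexᵥ (IntValuedOn (s ∷ S)) EvenValued (2 ℕ.* M)
      A/H′ = Index-* Index-A/K (Index-K/H B/J) (IntValuedOn-isSubgroup (s ∷ S)) K-isSubgroup
                     K⊆IntValuedOn EvenValued⊆K

open IndexFormula

open import Data.Integer as ℤ using (ℤ; +_; ∣_∣)
open import Data.Nat using (_*_; _^_; _!)
open import Data.Nat.Solver using (module +-*-Solver)
open import Data.Vec using (Vec; []; _∷_; lookup)

count-recurrence : ∀ n σ M m P D → M * n ! ≡ P * m → m * σ ≡ 2 ^ n * D → 2 * M * (σ * n !) ≡ 2 ^ suc n * (P * D)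
count-recurrence n σ M m P D M*n!≡P*m m*σ≡2ⁿD = begin
  2 * M * (σ * n !)     ≡⟨ solve 3 (λ M σ f → con 2 :* M :* (σ :* f) := con 2 :* σ :* (M :* f)) refl M σ (n !) ⟩
  2 * σ * (M * n !)     ≡⟨ cong (2 * σ *_) M*n!≡P*m ⟩
  2 * σ * (P * m)       ≡⟨ solve 3 (λ σ P m → con 2 :* σ :* (P :* m) := con 2 :* P :* (m :* σ)) refl σ P m ⟩
  2 * P * (m * σ)       ≡⟨ cong (2 * P *_) m*σ≡2ⁿD ⟩
  2 * P * (2 ^ n * D)   ≡⟨ solve 3 (λ P t D → con 2 :* P :* (t :* D) := con 2 :* t :* (P :* D)) refl P (2 ^ n) D ⟩
  2 ^ suc n * (P * D)   ∎
  where
  open ≡-Reasoning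
  open +-*-Solver

index-formula : ∀ {n} (S : Vec ℤ n) → Distinct S →
                ∃ λ m → Indexᵥ (IntValuedOn S) EvenValued m × m * superfactorial n ≡ 2 ^ n * diffProd S
index-formula [] _ =
  1 , Index-cong ((λ _ ()) , λ { {[]} _ _ → + 0 , refl }) (id , id) (Index-refl EvenValued-isSubgroup) , refl
index-formula {suc n} (s ∷ S) distinct =
  let m , A/H , m-count = index-formula S (Distinct-tail distinct)
      M , A′/H , M-count = Step.index-step s S (Distinct-tail distinct) (Distinct-head distinct) A/H
  in 2 * M , A′/H , trans (count-recurrence n (superfactorial n) M m P (diffProd S) M-count m-count)
                          (cong (2 ^ suc n *_) (sym (diffProd-∷ s S (Distinct-head distinct))))
  where
  P : ℕ
  P = ∏ λ i → ∣ lookup S i ℤ.- s ∣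

Index⇒QuotientCard : ∀ {d} {S : Vec ℤ (suc d)} {m} → Indexᵥ (IntValuedOn S) EvenValued m → QuotientCard S m
Index⇒QuotientCard idx = rep , rep∈ , rep-injective , λ f → rep-cover {f}
  where open Index idx

mainTheorem13 : (d : ℕ) (S : Vec ℤ (suc d)) → Distinct S →
    (∀ (f : Poly d) → InH f → InA S f) ×
    (∃ λ (m : ℕ) → QuotientCard S m × m * superfact d ≡ 2 ^ suc d * diffProd S)
mainTheorem13 d S distinct =
  let m , A/H , m-count = index-formula S distinct
  in EvenValued⊆IntValuedOn {n = suc d} S ,
     m , Index⇒QuotientCard {S = S} A/H , trans (cong (m *_) (superfact≡superfactorial d)) m-count
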